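{- Let $G$ be a connected graph, $v_1,\dots,v_k$ distinct vertices of $G$, and $W_1,\dots,W_k$ pairwise disjoint nonempty subsets of $V(G)\setminus\{v_1,\dots,v_k\}$ such that every vertex of $W_1$ has degree 1 in $G$. Then: (1) if $k=2$, and either all vertices of $W_2$ have degree 1 or $W_2=\{w_2\}$ for a single vertex $w_2$, then there exist 2 vertex-disjoint paths from $\{v_1,v_2\}$ to $\{W_1,W_2\}$, or there is a vertex $u$ that separates $\{v_1,v_2\}$ from $W_1\cup W_2$; (2) if $k=3$, $W_2=\{w_2\}$, $W_3=\{w_3\}$, and there exist 2 vertex-disjoint paths from $\{v_2,v_3\}$ to $\{\{w_2\},\{w_3\}\}$, then there exist 3 vertex-disjoint paths from $\{v_1,v_2,v_3\}$ to $\{W_1,\{w_2\},\{w_3\}\}$, or there are vertices $u_1,u_2$ such that $\{u_1,u_2\}$ separates $\{v_1,v_2,v_3\}$ from $W_1\cup\{w_2,w_3\}$.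
   Context: All graphs are finite and simple. For distinct vertices $v_1,\dots,v_k$ of $G$ and pairwise disjoint nonempty sets $W_1,\dots,W_k\subseteq V(G)\setminus\{v_1,\dots,v_k\}$, $k$ vertex-disjoint paths $P_1,\dots,P_k$ are said to be from $\{v_1,\dots,v_k\}$ to $\{W_1,\dots,W_k\}$ if for some permutation $\sigma$ of $\{1,\dots,k\}$, for each $i$, $V(P_i)\cap\{v_1,\dots,v_k\}=\{v_i\}$ and $V(P_i)\cap(W_1\cup\dots\cup W_k)$ consists of a single vertex, which lies in $W_{\sigma(i)}$. A set $U$ of vertices separates $X$ from $Y$ if every path from a vertex of $X$ to a vertex of $Y$ contains a vertex of $U$. -}

module Defs where

open import Data.Nat using (ℕ; zero; suc)
open import Data.Bool using (Bool; true; false; T; if_then_else_)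
open import Data.Fin using (Fin)
open import Data.Fin.Subset as S using (Subset; Nonempty; ⁅_⁆)
open import Data.Fin.Permutation using (Permutation′; _⟨$⟩ʳ_)
open import Data.List using (List; []; _∷_; head; last; map; allFin)
open import Data.Nat.ListAction using (sum)
open import Data.List.Membership.Propositional using (_∈_)
open import Data.List.Relation.Unary.Unique.Propositional using (Unique)
open import Data.List.Relation.Unary.Linked using (Linked)
open import Data.Maybe using (just)
open import Data.Product using (Σ; ∃; _×_; _,_)
open import Relation.Binary.PropositionalEquality using (_≡_; _≢_)
open import Relation.Nullary using (¬_)
open import Function.Definitions using (Injective)

record Graph (n : ℕ) : Set where
  field
    adj     : Fin n → Fin n → Bool
    adj-sym : ∀ x y → adj x y ≡ adj y x
    irrefl  : ∀ x → adj x x ≡ false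
open Graph public

Adj : ∀ {n} → Graph n → Fin n → Fin n → Set
Adj G x y = T (adj G x y)

degree : ∀ {n} → Graph n → Fin n → ℕ
degree {n} G x = sum (map (λ y → if adj G x y then 1 else 0) (allFin n))

IsPath : ∀ {n} → Graph n → List (Fin n) → Set
IsPath G p = (p ≢ []) × Unique p × Linked (Adj G) p

PathFromTo : ∀ {n} → Graph n → Fin n → Fin n → List (Fin n) → Set
PathFromTo G x y p = IsPath G p × head p ≡ just x × last p ≡ just y

Connected : ∀ {n} → Graph n → Set
Connected {n} G = ∀ (x y : Fin n) → ∃ λ p → PathFromTo G x y p

Separates : ∀ {n} → Graph n → (Fin n → Set) → (Fin n → Set) → (Fin n → Set) → Set
Separates {n} G U X Y =
  ∀ (x y : Fin n) (p : List (Fin n)) → X x → Y y → PathFromTo G x y p →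
  ∃ λ u → U u × u ∈ p

InVs : ∀ {n k} → (Fin k → Fin n) → Fin n → Set
InVs v x = ∃ λ i → v i ≡ x

InWs : ∀ {n k} → (Fin k → Subset n) → Fin n → Set
InWs W x = ∃ λ j → x S.∈ W j

Admissible : ∀ {n k} → (Fin k → Fin n) → (Fin k → Subset n) → Set
Admissible {n} {k} v W =
  Injective _≡_ _≡_ v ×
  (∀ (i j : Fin k) (x : Fin n) → x S.∈ W i → x S.∈ W j → i ≡ j) ×
  (∀ (i : Fin k) → Nonempty (W i)) ×
  (∀ (i j : Fin k) → ¬ (v i S.∈ W j))

DisjointPaths : ∀ {n} → Graph n → (k : ℕ) → (Fin k → Fin n) → (Fin k → Subset n) → Set
DisjointPaths {n} G k v W =
  Σ (Permutation′ k) λ σ → Σ (Fin k → List (Fin n)) λ P →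
    (∀ i → ∃ λ w → PathFromTo G (v i) w (P i) × w S.∈ W (σ ⟨$⟩ʳ i)) ×
    (∀ i j → v j ∈ P i → j ≡ i) ×
    (∀ i x → x ∈ P i → InWs W x → last (P i) ≡ just x) ×
    (∀ i j x → x ∈ P i → x ∈ P j → i ≡ j)

module Submission where

-- The engine is the augmenting step of Göring's proof of Menger's theorem: m disjoint paths from the
-- terminals to Y = ⋃ W_j either extend to m + 1 disjoint such paths keeping the old endpoints, or m
-- vertices separate the terminals from Y. A vertex of degree 1 is never interior to a path, so a path
-- from a terminal meets W₁ only at its last vertex. When the other targets are singletons, start from
-- the given paths (in (1), from one path v₁ → w₂): the new path cannot end in an occupied singleton,
-- hence it ends in W₁. When W₂ consists of leaves, contract W₂ onto one of its vertices and run the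
-- singleton argument in the contracted graph.

open import Defs
open import Data.Nat using (ℕ; zero; suc; _≤_; _<_; z≤n; s≤s)
open import Data.Nat.Properties using (≤-trans; m≤n⇒m≤1+n; n≤1+n; m≤n+m; 1+n≰n; n<1+n)
import Data.Nat.Properties as ℕ
open import Data.Nat.ListAction using (sum)
open import Data.Nat.Induction using (<-wellFounded)
open import Induction.WellFounded using (Acc; acc)
open import Data.Bool using (Bool; true; false; T; if_then_else_)
open import Data.Fin using (Fin; zero; suc; _≟_)
open import Data.Fin.Base using (punchOut)
open import Data.Fin.Properties using (any?; suc-injective; pigeonhole; punchOut-injective; <⇒≢)
open import Data.Fin.Subset using (Subset; Nonempty; ⁅_⁆) renaming (_∈_ to _∈S_)
open import Data.Fin.Subset.Properties using (x∈⁅x⁆; x∈⁅y⁆⇒x≡y) renaming (_∈?_ to _∈S?_)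
open import Data.Fin.Permutation using (Permutation′; _⟨$⟩ʳ_; _⟨$⟩ˡ_; permutation; inverseʳ; flip; _∘ₚ_; lift₀)
import Data.Fin.Permutation as Permutation
open import Data.List using (List; []; _∷_; allFin; map; last)
open import Data.List.Relation.Unary.Any using (here; there)
import Data.List.Relation.Unary.Any as Any
open import Data.List.Relation.Unary.All using ([])
open import Data.List.Relation.Unary.All.Properties using (All¬⇒¬Any; ¬Any⇒All¬)
open import Data.List.Relation.Unary.Linked using (Linked; [-]; _∷_)
open import Data.List.Relation.Unary.Unique.Propositional using (Unique; []; _∷_)
open import Data.List.Membership.Propositional.Properties using (∈-allFin)
open import Data.List.Relation.Binary.Subset.Propositional using (_⊆_)
open import Data.Maybe using (just)
open import Data.Maybe.Properties using (just-injective)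
open import Data.Product using (Σ; ∃; _×_; _,_; proj₁; proj₂)
open import Data.Sum using (_⊎_; inj₁; inj₂; [_,_]′)
open import Data.Empty using (⊥; ⊥-elim)
open import Data.Unit using (⊤; tt)
open import Level using (0ℓ)
open import Relation.Nullary using (¬_; Dec; yes; no)
open import Relation.Nullary.Decidable using (T?; _×-dec_; _⊎-dec_; ¬?)
open import Relation.Unary using (Pred; Decidable)
open import Relation.Binary.PropositionalEquality using (_≡_; refl; sym; trans; cong; subst)
open import Function using (_∘_)
open import Function.Definitions using (Injective)

module Walks {N : ℕ} (E : Fin N → Fin N → Set) (E? : ∀ x y → Dec (E x y)) where

  open import Data.List.Membership.Propositional using (_∈_; find)

  V : Set
  V = Fin N

  open import Data.List.Membership.DecPropositional (_≟_ {N}) using (_∈?_) public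

  infixr 5 _∷⟨_⟩_ _++ʷ_

  data Walk : V → V → Set where
    [_]    : (a : V) → Walk a a
    _∷⟨_⟩_ : (a : V) {b c : V} → E a b → Walk b c → Walk a c

  vertices : ∀ {a c} → Walk a c → List V
  vertices [ a ]         = a ∷ []
  vertices (a ∷⟨ _ ⟩ p) = a ∷ vertices p

  _++ʷ_ : ∀ {a b c} → Walk a b → Walk b c → Walk a c
  [ _ ]          ++ʷ q = q
  (a ∷⟨ e ⟩ p) ++ʷ q = a ∷⟨ e ⟩ (p ++ʷ q)

  start∈ : ∀ {a c} (p : Walk a c) → a ∈ vertices p
  start∈ [ a ]         = here refl
  start∈ (a ∷⟨ _ ⟩ p) = here refl

  end∈ : ∀ {a c} (p : Walk a c) → c ∈ vertices p
  end∈ [ a ]         = here refl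
  end∈ (a ∷⟨ _ ⟩ p) = there (end∈ p)

  ∈-++ʷ⁺ˡ : ∀ {a b c} (p : Walk a b) (q : Walk b c) → vertices p ⊆ vertices (p ++ʷ q)
  ∈-++ʷ⁺ˡ [ _ ]        q (here refl) = start∈ q
  ∈-++ʷ⁺ˡ (a ∷⟨ e ⟩ p) q (here refl) = here refl
  ∈-++ʷ⁺ˡ (a ∷⟨ e ⟩ p) q (there m)   = there (∈-++ʷ⁺ˡ p q m)

  ∈-++ʷ⁺ʳ : ∀ {a b c} (p : Walk a b) (q : Walk b c) → vertices q ⊆ vertices (p ++ʷ q)
  ∈-++ʷ⁺ʳ [ _ ]        q m = m
  ∈-++ʷ⁺ʳ (a ∷⟨ e ⟩ p) q m = there (∈-++ʷ⁺ʳ p q m)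

  ∈-++ʷ⁻ : ∀ {a b c y} (p : Walk a b) (q : Walk b c) →
           y ∈ vertices (p ++ʷ q) → y ∈ vertices p ⊎ y ∈ vertices q
  ∈-++ʷ⁻ [ _ ]        q m           = inj₂ m
  ∈-++ʷ⁻ (a ∷⟨ e ⟩ p) q (here refl) = inj₁ (here refl)
  ∈-++ʷ⁻ (a ∷⟨ e ⟩ p) q (there m)   = Data.Sum.map₁ there (∈-++ʷ⁻ p q m)

  splitAt : ∀ {a c x} (p : Walk a c) → x ∈ vertices p →
            Σ (Walk a x) λ p₁ → Σ (Walk x c) λ p₂ → p ≡ p₁ ++ʷ p₂
  splitAt [ a ]        (here refl) = [ a ] , [ a ] , refl
  splitAt (a ∷⟨ e ⟩ p) (here refl) = [ a ] , a ∷⟨ e ⟩ p , refl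
  splitAt (a ∷⟨ e ⟩ p) (there m) with splitAt p m
  ... | p₁ , p₂ , eq = a ∷⟨ e ⟩ p₁ , p₂ , cong (a ∷⟨ e ⟩_) eq

  Simple : ∀ {a c} → Walk a c → Set
  Simple [ a ]         = ⊤
  Simple (a ∷⟨ _ ⟩ p) = (¬ a ∈ vertices p) × Simple p

  simple-++ʷ⁻ : ∀ {a b c} (p : Walk a b) (q : Walk b c) → Simple (p ++ʷ q) →
                Simple p × Simple q × (∀ y → y ∈ vertices p → y ∈ vertices q → y ≡ b)
  simple-++ʷ⁻ [ _ ] q s = tt , s , λ { y (here refl) _ → refl }
  simple-++ʷ⁻ (a ∷⟨ e ⟩ p) q (a∉ , s) with simple-++ʷ⁻ p q s
  ... | sp , sq , meet = ((λ m → a∉ (∈-++ʷ⁺ˡ p q m)) , sp) , sq , meet′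
    where
    meet′ : ∀ y → y ∈ vertices (a ∷⟨ e ⟩ p) → y ∈ vertices q → y ≡ _
    meet′ y (here refl) m = ⊥-elim (a∉ (∈-++ʷ⁺ʳ p q m))
    meet′ y (there m′)  m = meet y m′ m

  record Shortcut {a c} (p : Walk a c) : Set where
    constructor shortcut
    field
      shortWalk   : Walk a c
      shortSimple : Simple shortWalk
      short⊆      : vertices shortWalk ⊆ vertices p
  open Shortcut public

  simpleSuffix : ∀ {a c x} (p : Walk a c) → Simple p → x ∈ vertices p →
                 Σ (Walk x c) λ q → Simple q × vertices q ⊆ vertices p
  simpleSuffix p s m with splitAt p m
  ... | p₁ , p₂ , refl = p₂ , proj₁ (proj₂ (simple-++ʷ⁻ p₁ p₂ s)) , ∈-++ʷ⁺ʳ p₁ p₂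

  suffixFrom : ∀ {a c z} (p : Walk a c) → Simple p → z ∈ vertices p → ¬ z ≡ a →
               Σ (Walk z c) λ q → vertices q ⊆ vertices p × ¬ a ∈ vertices q
  suffixFrom p s m z≢a with splitAt p m
  ... | p₁ , p₂ , refl =
    p₂ , ∈-++ʷ⁺ʳ p₁ p₂ ,
    λ a∈p₂ → z≢a (sym (proj₂ (proj₂ (simple-++ʷ⁻ p₁ p₂ s)) _ (start∈ p₁) a∈p₂))

  -- If a recurs in the simplified tail, the cycle through a is cut off.
  simplify : ∀ {a c} (p : Walk a c) → Shortcut p
  simplify [ a ] = shortcut [ a ] tt (λ m → m)
  simplify (a ∷⟨ e ⟩ p) with simplify p
  ... | shortcut q s q⊆p with a ∈? vertices q
  ...   | yes a∈q = let r , sr , r⊆q = simpleSuffix q s a∈q in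
                    shortcut r sr (λ m → there (q⊆p (r⊆q m)))
  ...   | no a∉q = shortcut (a ∷⟨ e ⟩ q) (a∉q , s) ⊆cons
    where
    ⊆cons : vertices (a ∷⟨ e ⟩ q) ⊆ vertices (a ∷⟨ e ⟩ p)
    ⊆cons (here refl) = here refl
    ⊆cons (there m)   = there (q⊆p m)

  splitAtLast : ∀ {a c} {D : Pred V 0ℓ} → Decidable D → (p : Walk a c) →
                (∀ y → y ∈ vertices p → ¬ D y) ⊎
                (Σ V λ x → D x × Σ (Walk a x) λ p₁ → Σ (Walk x c) λ p₂ → p ≡ p₁ ++ʷ p₂ ×
                   (∀ y → y ∈ vertices p₂ → D y → y ≡ x))
  splitAtLast D? [ a ] with D? a
  ... | yes da = inj₂ (a , da , [ a ] , [ a ] , refl , λ { y (here refl) _ → refl })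
  ... | no ¬da = inj₁ λ { y (here refl) → ¬da }
  splitAtLast D? (a ∷⟨ e ⟩ p) with splitAtLast D? p
  ... | inj₂ (x , dx , p₁ , p₂ , eq , last) =
    inj₂ (x , dx , a ∷⟨ e ⟩ p₁ , p₂ , cong (a ∷⟨ e ⟩_) eq , last)
  ... | inj₁ avoid with D? a
  ...   | yes da = inj₂ (a , da , [ a ] , a ∷⟨ e ⟩ p , refl , only-a)
    where
    only-a : ∀ y → y ∈ vertices (a ∷⟨ e ⟩ p) → _ → y ≡ a
    only-a y (here refl) _  = refl
    only-a y (there m)   dy = ⊥-elim (avoid y m dy)
  ...   | no ¬da = inj₁ avoid′
    where
    avoid′ : ∀ y → y ∈ vertices (a ∷⟨ e ⟩ p) → _
    avoid′ y (here refl) = ¬da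
    avoid′ y (there m)   = avoid y m

  splitAtFirst : ∀ {a c} {D : Pred V 0ℓ} → Decidable D → (p : Walk a c) → D c →
                 Σ V λ x → D x × Σ (Walk a x) λ p₁ → Σ (Walk x c) λ p₂ → p ≡ p₁ ++ʷ p₂ ×
                   (∀ y → y ∈ vertices p₁ → D y → y ≡ x)
  splitAtFirst D? [ a ] dc = a , dc , [ a ] , [ a ] , refl , λ { y (here refl) _ → refl }
  splitAtFirst D? (a ∷⟨ e ⟩ p) dc with D? a
  ... | yes da = a , da , [ a ] , a ∷⟨ e ⟩ p , refl , λ { y (here refl) _ → refl }
  ... | no ¬da with splitAtFirst D? p dc
  ...   | x , dx , p₁ , p₂ , eq , first = x , dx , a ∷⟨ e ⟩ p₁ , p₂ , cong (a ∷⟨ e ⟩_) eq , first′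
    where
    first′ : ∀ y → y ∈ vertices (a ∷⟨ e ⟩ p₁) → _ → y ≡ x
    first′ y (here refl) dy = ⊥-elim (¬da dy)
    first′ y (there m)   dy = first y m dy

  incident : ∀ {a b c y} (e : E a b) (p : Walk b c) → y ∈ vertices (a ∷⟨ e ⟩ p) →
             (∃ λ z → E y z) ⊎ (∃ λ z → E z y)
  incident e p            (here refl)         = inj₁ (_ , e)
  incident {a} e [ b ]    (there (here refl)) = inj₂ (a , e)
  incident e (b ∷⟨ e′ ⟩ p) (there m)          = incident e′ p m

  countOutside : {P : Pred V 0ℓ} → Decidable P → List V → ℕ
  countOutside P? [] = 0
  countOutside P? (x ∷ xs) with P? x
  ... | yes _ = countOutside P? xs
  ... | no _  = suc (countOutside P? xs)

  module _ {P Q : Pred V 0ℓ} (P? : Decidable P) (Q? : Decidable Q) (P⊆Q : ∀ x → P x → Q x) where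

    countOutside-antitone : ∀ xs → countOutside Q? xs ≤ countOutside P? xs
    countOutside-antitone [] = z≤n
    countOutside-antitone (x ∷ xs) with P? x | Q? x
    ... | yes _  | yes _  = countOutside-antitone xs
    ... | yes px | no ¬qx = ⊥-elim (¬qx (P⊆Q x px))
    ... | no _   | yes _  = m≤n⇒m≤1+n (countOutside-antitone xs)
    ... | no _   | no _   = s≤s (countOutside-antitone xs)

    countOutside-strict : ∀ z xs → z ∈ xs → ¬ P z → Q z → countOutside Q? xs < countOutside P? xs
    countOutside-strict z (x ∷ xs) (here refl) ¬pz qz with P? x | Q? x
    ... | yes px | _      = ⊥-elim (¬pz px)
    ... | no _   | yes _  = s≤s (countOutside-antitone xs)
    ... | no _   | no ¬qz = ⊥-elim (¬qz qz)
    countOutside-strict z (x ∷ xs) (there m) ¬pz qz with P? x | Q? x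
    ... | yes _  | yes _  = countOutside-strict z xs m ¬pz qz
    ... | yes px | no ¬qx = ⊥-elim (¬qx (P⊆Q x px))
    ... | no _   | yes _  = ≤-trans (countOutside-strict z xs m ¬pz qz) (n≤1+n _)
    ... | no _   | no _   = s≤s (countOutside-strict z xs m ¬pz qz)

  #outside : {P : Pred V 0ℓ} → Decidable P → ℕ
  #outside P? = countOutside P? (allFin N)

  #outside-strict : {P Q : Pred V 0ℓ} (P? : Decidable P) (Q? : Decidable Q) → (∀ x → P x → Q x) →
                    ∀ z → ¬ P z → Q z → #outside Q? < #outside P?
  #outside-strict P? Q? P⊆Q z = countOutside-strict P? Q? P⊆Q z (allFin N) (∈-allFin z)

  Avoids : Pred V 0ℓ → ∀ {a c} → Walk a c → Set
  Avoids S p = ∀ z → z ∈ vertices p → ¬ S z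

  record IsXYPath (X Y : Pred V 0ℓ) {a c} (p : Walk a c) : Set where
    field
      simple     : Simple p
      startX     : X a
      endY       : Y c
      onlyStartX : ∀ y → y ∈ vertices p → X y → y ≡ a
      onlyEndY   : ∀ y → y ∈ vertices p → Y y → y ≡ c
  open IsXYPath public

  record XYPath (X Y : Pred V 0ℓ) : Set where
    constructor xyPath
    field
      {start end} : V
      walk        : Walk start end
      isXYPath    : IsXYPath X Y walk
  open XYPath public

  SeparatesWalks : (U X Y : Pred V 0ℓ) → Set
  SeparatesWalks U X Y = ∀ {a c} (p : Walk a c) → X a → Y c → ∃ λ u → U u × u ∈ vertices p

  xyPathWithin : ∀ {X Y : Pred V 0ℓ} → Decidable X → Decidable Y → ∀ {a c} (p : Walk a c) → X a → Y c →
                 Σ (XYPath X Y) λ r → vertices (walk r) ⊆ vertices p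
  xyPathWithin X? Y? p xa yc with splitAtLast X? p
  ... | inj₁ noX = ⊥-elim (noX _ (start∈ p) xa)
  ... | inj₂ (x , xx , p₁ , p₂ , refl , lastX) with splitAtFirst Y? p₂ yc
  ...   | y , yy , q₁ , q₂ , refl , firstY with simplify q₁
  ...     | shortcut r sr r⊆q₁ =
    xyPath r (record { simple = sr ; startX = xx ; endY = yy
                     ; onlyStartX = λ z m xz → lastX z (∈-++ʷ⁺ˡ q₁ q₂ (r⊆q₁ m)) xz
                     ; onlyEndY = λ z m yz → firstY z (r⊆q₁ m) yz }) ,
    λ m → ∈-++ʷ⁺ʳ p₁ (q₁ ++ʷ q₂) (∈-++ʷ⁺ˡ q₁ q₂ (r⊆q₁ m))

  ReachesAvoiding : (X S : Pred V 0ℓ) → Pred V 0ℓ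
  ReachesAvoiding X S y = Σ V λ a → X a × Σ (Walk a y) (Avoids S)

  PathAvoidingOrSeparator : (X Y S : Pred V 0ℓ) → Set
  PathAvoidingOrSeparator X Y S = (Σ (XYPath X Y) λ r → Avoids S (walk r)) ⊎ SeparatesWalks S X Y

  module Reachability {X Y S : Pred V 0ℓ} (X? : Decidable X) (Y? : Decidable Y) (S? : Decidable S) where

    ClosedAvoiding : Pred V 0ℓ → Set
    ClosedAvoiding R = ∀ a b → R a → E a b → ¬ S b → R b

    closed⇒reaches-end : ∀ {R} → ClosedAvoiding R → ∀ {a c} (p : Walk a c) → R a → Avoids S p → R c
    closed⇒reaches-end closed [ a ]        ra avoid = ra
    closed⇒reaches-end closed (a ∷⟨ e ⟩ p) ra avoid =
      closed⇒reaches-end closed p (closed _ _ ra e (avoid _ (there (start∈ p)))) (λ z m → avoid z (there m))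

    atFixpoint : ∀ {R} → Decidable R → (∀ y → X y → ¬ S y → R y) → (∀ y → R y → ReachesAvoiding X S y) →
                 ClosedAvoiding R → PathAvoidingOrSeparator X Y S
    atFixpoint {R} R? initial reaches closed with any? (λ y → R? y ×-dec Y? y)
    ... | yes (y , ry , yy) with reaches y ry
    ...   | a , xa , p , avoid with xyPathWithin X? Y? p xa yy
    ...     | r , r⊆p = inj₁ (r , λ z m → avoid z (r⊆p m))
    atFixpoint {R} R? initial reaches closed | no ¬RY = inj₂ separates
      where
      separates : SeparatesWalks S X Y
      separates p xa yc with Any.any? S? (vertices p)
      ... | yes hit = let u , m , su = find hit in u , su , m
      ... | no miss = ⊥-elim (¬RY (_ , closed⇒reaches-end closed p (initial _ xa (avoid _ (start∈ p))) avoid , yc))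
        where
        avoid : Avoids S p
        avoid z m sz = miss (Any.map (λ { refl → sz }) m)

    grow : ∀ {R} (R? : Decidable R) → Acc _<_ (#outside R?) →
           (∀ y → X y → ¬ S y → R y) → (∀ y → R y → ReachesAvoiding X S y) → PathAvoidingOrSeparator X Y S
    grow {R} R? (acc smaller) initial reaches
      with any? (λ b → any? (λ a → R? a ×-dec E? a b) ×-dec ¬? (S? b) ×-dec ¬? (R? b))
    ... | no noEdge = atFixpoint R? initial reaches closed
      where
      closed : ClosedAvoiding R
      closed a b ra e ¬sb with R? b
      ... | yes rb = rb
      ... | no ¬rb = ⊥-elim (noEdge (b , (a , ra , e) , ¬sb , ¬rb))
    ... | yes (b , (a , ra , e) , ¬sb , ¬rb) =
      grow R′? (smaller (#outside-strict R? R′? (λ _ → inj₁) b ¬rb (inj₂ refl)))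
           (λ y xy ¬sy → inj₁ (initial y xy ¬sy)) reaches′
      where
      R′ : Pred V 0ℓ
      R′ y = R y ⊎ y ≡ b
      R′? : Decidable R′
      R′? y = R? y ⊎-dec (y ≟ b)
      reaches′ : ∀ y → R′ y → ReachesAvoiding X S y
      reaches′ y (inj₁ ry)   = reaches y ry
      reaches′ y (inj₂ refl) with reaches a ra
      ... | a₀ , xa₀ , p , avoid = a₀ , xa₀ , (p ++ʷ a ∷⟨ e ⟩ [ b ]) , avoid′
        where
        avoid′ : Avoids S (p ++ʷ a ∷⟨ e ⟩ [ b ])
        avoid′ z m with ∈-++ʷ⁻ p _ m
        ... | inj₁ m′                 = avoid z m′
        ... | inj₂ (here refl)        = avoid z (end∈ p)
        ... | inj₂ (there (here refl)) = ¬sb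

    pathAvoidingOrSeparator : PathAvoidingOrSeparator X Y S
    pathAvoidingOrSeparator =
      grow R₀? (<-wellFounded _) (λ y xy ¬sy → xy , ¬sy)
           (λ y (xy , ¬sy) → y , xy , [ y ] , λ { z (here refl) → ¬sy })
      where
      R₀? : Decidable (λ y → X y × ¬ S y)
      R₀? y = X? y ×-dec ¬? (S? y)

  module Augmentation {X : Pred V 0ℓ} (X? : Decidable X) where

    record Linkage (Y : Pred V 0ℓ) (m : ℕ) : Set where
      field
        path     : Fin m → XYPath X Y
        disjoint : ∀ i j y → y ∈ vertices (walk (path i)) → y ∈ vertices (walk (path j)) → i ≡ j
    open Linkage public

    Extends : ∀ {Y Y′ m} → Linkage Y′ (suc m) → Linkage Y m → Set
    Extends L F = ∀ i → end (path L (suc i)) ≡ end (path F i)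

    Separator : ℕ → Pred V 0ℓ → Set
    Separator m Y = Σ (Fin m → V) λ g → SeparatesWalks (λ u → ∃ λ j → g j ≡ u) X Y

    ExtensionOrSeparator : ∀ {m} (Y : Pred V 0ℓ) → Linkage Y m → Set
    ExtensionOrSeparator {m} Y F = (Σ (Linkage Y (suc m)) λ L → Extends L F) ⊎ Separator m Y

    concatXY : ∀ {Y : Pred V 0ℓ} {a b b′ c} (p : Walk a b) (b≡b′ : b ≡ b′) (q : Walk b′ c) → X a → Y c →
      (∀ y → y ∈ vertices p → X y → y ≡ a) → (∀ y → y ∈ vertices q → X y → y ≡ a) →
      (∀ y → y ∈ vertices p → Y y → y ≡ c) → (∀ y → y ∈ vertices q → Y y → y ≡ c) →
      Σ (Walk a c) λ w → IsXYPath X Y w × (∀ y → y ∈ vertices w → y ∈ vertices p ⊎ y ∈ vertices q)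
    concatXY p refl q xa yc pX qX pY qY with simplify (p ++ʷ q)
    ... | shortcut w s w⊆ =
      w , record { simple = s ; startX = xa ; endY = yc
                 ; onlyStartX = λ y m xy → [ (λ m′ → pX y m′ xy) , (λ m′ → qX y m′ xy) ]′ (∈-++ʷ⁻ p q (w⊆ m))
                 ; onlyEndY   = λ y m yy → [ (λ m′ → pY y m′ yy) , (λ m′ → qY y m′ yy) ]′ (∈-++ʷ⁻ p q (w⊆ m)) }
        , λ y m → ∈-++ʷ⁻ p q (w⊆ m)

    replaceTwo : ∀ {m} {Y Y′ : Pred V 0ℓ} → (∀ y → Y y → Y′ y) →
      (F : Linkage Y m) (j : Fin m) (Q : Linkage Y′ (suc m)) →
      (∀ i → ¬ i ≡ j → end (path Q (suc i)) ≡ end (path F i)) →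
      (Z J : XYPath X Y) → end J ≡ end (path F j) →
      (∀ y → y ∈ vertices (walk Z) → y ∈ vertices (walk J) → ⊥) →
      (∀ i → ¬ i ≡ j → ∀ y → y ∈ vertices (walk (path Q (suc i))) →
         y ∈ vertices (walk Z) ⊎ y ∈ vertices (walk J) → ⊥) →
      Σ (Linkage Y (suc m)) λ L → Extends L F
    replaceTwo {m} {Y} Y⊆Y′ F j Q endQ Z J endJ Z∩J Q∩ZJ = record { path = path′ ; disjoint = disjoint′ } , ends′
      where
      kept : ∀ i → ¬ i ≡ j → XYPath X Y
      kept i i≢j = xyPath (walk (path Q (suc i))) (record
        { simple = simple (isXYPath (path Q (suc i))) ; startX = startX (isXYPath (path Q (suc i)))
        ; endY = subst Y (sym (endQ i i≢j)) (endY (isXYPath (path F i)))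
        ; onlyStartX = onlyStartX (isXYPath (path Q (suc i)))
        ; onlyEndY = λ y m yy → onlyEndY (isXYPath (path Q (suc i))) y m (Y⊆Y′ y yy) })
      slot : ∀ i → Dec (i ≡ j) → XYPath X Y
      slot i (yes _)  = J
      slot i (no i≢j) = kept i i≢j
      path′ : Fin (suc m) → XYPath X Y
      path′ zero    = Z
      path′ (suc i) = slot i (i ≟ j)
      ends′ : ∀ i → end (path′ (suc i)) ≡ end (path F i)
      ends′ i with i ≟ j
      ... | yes refl = endJ
      ... | no i≢j   = endQ i i≢j
      data OnSlot (y : V) : Fin (suc m) → Set where
        onZ : y ∈ vertices (walk Z) → OnSlot y zero
        onJ : ∀ {i} → i ≡ j → y ∈ vertices (walk J) → OnSlot y (suc i)
        onQ : ∀ {i} → ¬ i ≡ j → y ∈ vertices (walk (path Q (suc i))) → OnSlot y (suc i)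
      onSlot : ∀ t y → y ∈ vertices (walk (path′ t)) → OnSlot y t
      onSlot zero    y m = onZ m
      onSlot (suc i) y m with i ≟ j
      ... | yes i≡j = onJ i≡j m
      ... | no i≢j  = onQ i≢j m
      sameSlot : ∀ {t t′} y → OnSlot y t → OnSlot y t′ → t ≡ t′
      sameSlot y (onZ _)          (onZ _)          = refl
      sameSlot y (onZ m)          (onJ _ m′)       = ⊥-elim (Z∩J y m m′)
      sameSlot y (onZ m)          (onQ i≢j m′)     = ⊥-elim (Q∩ZJ _ i≢j y m′ (inj₁ m))
      sameSlot y (onJ _ m)        (onZ m′)         = ⊥-elim (Z∩J y m′ m)
      sameSlot y (onJ refl _)     (onJ refl _)     = refl
      sameSlot y (onJ _ m)        (onQ i≢j m′)     = ⊥-elim (Q∩ZJ _ i≢j y m′ (inj₂ m))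
      sameSlot y (onQ i≢j m)      (onZ m′)         = ⊥-elim (Q∩ZJ _ i≢j y m (inj₁ m′))
      sameSlot y (onQ i≢j m)      (onJ _ m′)       = ⊥-elim (Q∩ZJ _ i≢j y m (inj₂ m′))
      sameSlot y (onQ _ m)        (onQ _ m′)       = disjoint Q _ _ y m m′
      disjoint′ : ∀ t t′ y → y ∈ vertices (walk (path′ t)) → y ∈ vertices (walk (path′ t′)) → t ≡ t′
      disjoint′ t t′ y m m′ = sameSlot y (onSlot t y m) (onSlot t′ y m′)

    OnLinkage : ∀ {Y m} → Linkage Y m → Pred V 0ℓ
    OnLinkage F y = ∃ λ i → y ∈ vertices (walk (path F i))

    EndOf : ∀ {Y m} → Linkage Y m → Pred V 0ℓ
    EndOf F u = ∃ λ j → end (path F j) ≡ u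

    module Reroute {m} {Y : Pred V 0ℓ} (Y? : Decidable Y) (F : Linkage Y m)
        (R : XYPath X Y) (R-avoids : Avoids (EndOf F) (walk R))
        (x : V) (j : Fin m) (x∈Pj : x ∈ vertices (walk (path F j)))
        (R₁ : Walk (start R) x) (R₂ : Walk x (end R)) (R≡ : walk R ≡ R₁ ++ʷ R₂)
        (R₂-last : ∀ y → y ∈ vertices R₂ → OnLinkage F y → y ≡ x)
        (recurse : ∀ {Y′} (Y′? : Decidable Y′) → #outside Y′? < #outside Y? →
                   (F′ : Linkage Y′ m) → ExtensionOrSeparator Y′ F′)
        where

      P : ∀ i → Walk (start (path F i)) (end (path F i))
      P i = walk (path F i)

      Pj-split : Σ (Walk (start (path F j)) x) λ P₁ → Σ (Walk x (end (path F j))) λ P₂ → P j ≡ P₁ ++ʷ P₂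
      Pj-split = splitAt (P j) x∈Pj

      P₁ : Walk (start (path F j)) x
      P₁ = proj₁ Pj-split
      P₂ : Walk x (end (path F j))
      P₂ = proj₁ (proj₂ Pj-split)

      P₁⊆Pj : vertices P₁ ⊆ vertices (P j)
      P₁⊆Pj m = subst (λ w → _ ∈ vertices w) (sym (proj₂ (proj₂ Pj-split))) (∈-++ʷ⁺ˡ P₁ P₂ m)
      P₂⊆Pj : vertices P₂ ⊆ vertices (P j)
      P₂⊆Pj m = subst (λ w → _ ∈ vertices w) (sym (proj₂ (proj₂ Pj-split))) (∈-++ʷ⁺ʳ P₁ P₂ m)

      P₁P₂-simple : Simple P₁ × Simple P₂ × (∀ y → y ∈ vertices P₁ → y ∈ vertices P₂ → y ≡ x)
      P₁P₂-simple = simple-++ʷ⁻ P₁ P₂ (subst Simple (proj₂ (proj₂ Pj-split)) (simple (isXYPath (path F j))))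
      P₁∩P₂ : ∀ y → y ∈ vertices P₁ → y ∈ vertices P₂ → y ≡ x
      P₁∩P₂ = proj₂ (proj₂ P₁P₂-simple)

      R₂⊆R : vertices R₂ ⊆ vertices (walk R)
      R₂⊆R m = subst (λ w → _ ∈ vertices w) (sym R≡) (∈-++ʷ⁺ʳ R₁ R₂ m)
      R₁R₂-simple : Simple R₁ × Simple R₂ × (∀ y → y ∈ vertices R₁ → y ∈ vertices R₂ → y ≡ x)
      R₁R₂-simple = simple-++ʷ⁻ R₁ R₂ (subst Simple R≡ (simple (isXYPath R)))

      R₂∩P : ∀ {y i} → y ∈ vertices R₂ → y ∈ vertices (P i) → y ≡ x
      R₂∩P m m′ = R₂-last _ m (_ , m′)

      x∉Y : ¬ Y x
      x∉Y yx = R-avoids x (R₂⊆R (start∈ R₂)) (j , sym (onlyEndY (isXYPath (path F j)) x x∈Pj yx))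

      P₂-onlyX : ∀ y → y ∈ vertices P₂ → X y → y ≡ x
      P₂-onlyX y m xy with onlyStartX (isXYPath (path F j)) y (P₂⊆Pj m) xy
      ... | refl = P₁∩P₂ y (start∈ P₁) m
      R₂-onlyX : ∀ y → y ∈ vertices R₂ → X y → y ≡ x
      R₂-onlyX y m xy with onlyStartX (isXYPath R) y (R₂⊆R m) xy
      ... | refl = proj₂ (proj₂ R₁R₂-simple) y (start∈ R₁) m
      P₂-onlyY : ∀ y → y ∈ vertices P₂ → Y y → y ≡ end (path F j)
      P₂-onlyY y m = onlyEndY (isXYPath (path F j)) y (P₂⊆Pj m)
      R₂-onlyY : ∀ y → y ∈ vertices R₂ → Y y → y ≡ end R
      R₂-onlyY y m = onlyEndY (isXYPath R) y (R₂⊆R m)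

      -- The paths are now allowed to stop anywhere on P₂ or R₂; this strictly enlarges Y.
      Y′ : Pred V 0ℓ
      Y′ y = Y y ⊎ (y ∈ vertices P₂ ⊎ y ∈ vertices R₂)
      Y′? : Decidable Y′
      Y′? y = Y? y ⊎-dec (y ∈? vertices P₂ ⊎-dec y ∈? vertices R₂)

      Y′-smaller : #outside Y′? < #outside Y?
      Y′-smaller = #outside-strict Y? Y′? (λ _ → inj₁) x x∉Y (inj₂ (inj₁ (start∈ P₂)))

      P₁-isXY : IsXYPath X Y′ P₁
      P₁-isXY = record { simple = proj₁ P₁P₂-simple ; startX = startX (isXYPath (path F j))
                       ; endY = inj₂ (inj₁ (start∈ P₂))
                       ; onlyStartX = λ y m → onlyStartX (isXYPath (path F j)) y (P₁⊆Pj m) ; onlyEndY = onlyY′ }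
        where
        onlyY′ : ∀ y → y ∈ vertices P₁ → Y′ y → y ≡ x
        onlyY′ y m (inj₁ yy) with onlyEndY (isXYPath (path F j)) y (P₁⊆Pj m) yy
        ... | refl = P₁∩P₂ y m (end∈ P₂)
        onlyY′ y m (inj₂ (inj₁ m₂)) = P₁∩P₂ y m m₂
        onlyY′ y m (inj₂ (inj₂ m₂)) = R₂∩P m₂ (P₁⊆Pj m)

      Pi-isXY : ∀ i → ¬ i ≡ j → IsXYPath X Y′ (P i)
      Pi-isXY i i≢j = record { simple = simple (isXYPath (path F i)) ; startX = startX (isXYPath (path F i))
                             ; endY = inj₁ (endY (isXYPath (path F i)))
                             ; onlyStartX = onlyStartX (isXYPath (path F i)) ; onlyEndY = onlyY′ }
        where
        onlyY′ : ∀ y → y ∈ vertices (P i) → Y′ y → y ≡ end (path F i)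
        onlyY′ y m (inj₁ yy)        = onlyEndY (isXYPath (path F i)) y m yy
        onlyY′ y m (inj₂ (inj₁ m₂)) = ⊥-elim (i≢j (disjoint F i j y m (P₂⊆Pj m₂)))
        onlyY′ y m (inj₂ (inj₂ m₂)) with R₂∩P m₂ m
        ... | refl = ⊥-elim (i≢j (disjoint F i j x m x∈Pj))

      truncatedSlot : ∀ i → Dec (i ≡ j) → XYPath X Y′
      truncatedSlot i (yes _)  = xyPath P₁ P₁-isXY
      truncatedSlot i (no i≢j) = xyPath (P i) (Pi-isXY i i≢j)

      truncatedSlot⊆ : ∀ i d → vertices (walk (truncatedSlot i d)) ⊆ vertices (P i)
      truncatedSlot⊆ i (yes refl) = P₁⊆Pj
      truncatedSlot⊆ i (no _)     = λ m → m

      F′ : Linkage Y′ m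
      F′ = record { path = λ i → truncatedSlot i (i ≟ j)
                  ; disjoint = λ i i′ y m m′ → disjoint F i i′ y (truncatedSlot⊆ i (i ≟ j) m)
                                                                 (truncatedSlot⊆ i′ (i′ ≟ j) m′) }

      F′-end-j : end (path F′ j) ≡ x
      F′-end-j with j ≟ j
      ... | yes refl = refl
      ... | no j≢j   = ⊥-elim (j≢j refl)

      F′-end : ∀ i → ¬ i ≡ j → end (path F′ i) ≡ end (path F i)
      F′-end i i≢j with i ≟ j
      ... | yes i≡j = ⊥-elim (i≢j i≡j)
      ... | no _    = refl

      module Recombine (Q : Linkage Y′ (suc m)) (Q-extends : Extends Q F′) where

        Q₀ : Walk (start (path Q zero)) (end (path Q zero))
        Q₀ = walk (path Q zero)
        z : V
        z = end (path Q zero)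
        Qj : Walk (start (path Q (suc j))) (end (path Q (suc j)))
        Qj = walk (path Q (suc j))

        Qj-end : end (path Q (suc j)) ≡ x
        Qj-end = trans (Q-extends j) F′-end-j
        Q-end : ∀ i → ¬ i ≡ j → end (path Q (suc i)) ≡ end (path F i)
        Q-end i i≢j = trans (Q-extends i) (F′-end i i≢j)

        Q-onlyY′ : ∀ t y → y ∈ vertices (walk (path Q t)) → Y′ y → y ≡ end (path Q t)
        Q-onlyY′ t = onlyEndY (isXYPath (path Q t))

        x∈Qj : x ∈ vertices Qj
        x∈Qj = subst (_∈ vertices Qj) Qj-end (end∈ Qj)
        z≢x : ¬ z ≡ x
        z≢x z≡x with disjoint Q zero (suc j) z (end∈ Q₀) (subst (_∈ vertices Qj) (sym z≡x) x∈Qj)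
        ... | ()

        Qj-avoidsY : ∀ y → y ∈ vertices Qj → ¬ Y y
        Qj-avoidsY y m yy with trans (Q-onlyY′ (suc j) y m (inj₁ yy)) Qj-end
        ... | refl = x∉Y yy
        Q₀-onlyY : ∀ y → y ∈ vertices Q₀ → Y y → y ≡ z
        Q₀-onlyY y m yy = Q-onlyY′ zero y m (inj₁ yy)
        Qj-onlyX : ∀ y → y ∈ vertices Qj → X y → y ≡ start (path Q (suc j))
        Qj-onlyX = onlyStartX (isXYPath (path Q (suc j)))
        x-onlyX : ∀ y → y ≡ x → X y → y ≡ start (path Q (suc j))
        x-onlyX y refl xy = Qj-onlyX x x∈Qj xy

        Q₀∩Qj : ∀ y → y ∈ vertices Q₀ → y ∈ vertices Qj → ⊥
        Q₀∩Qj y m m′ with disjoint Q zero (suc j) y m m′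
        ... | ()
        Qj∩P₂ : ∀ y → y ∈ vertices Qj → y ∈ vertices P₂ → y ≡ x
        Qj∩P₂ y m m′ = trans (Q-onlyY′ (suc j) y m (inj₂ (inj₁ m′))) Qj-end
        Qj∩R₂ : ∀ y → y ∈ vertices Qj → y ∈ vertices R₂ → y ≡ x
        Qj∩R₂ y m m′ = trans (Q-onlyY′ (suc j) y m (inj₂ (inj₂ m′))) Qj-end
        Q₀∩P₂ : ∀ y → y ∈ vertices Q₀ → y ∈ vertices P₂ → y ≡ z
        Q₀∩P₂ y m m′ = Q-onlyY′ zero y m (inj₂ (inj₁ m′))
        Q₀∩R₂ : ∀ y → y ∈ vertices Q₀ → y ∈ vertices R₂ → y ≡ z
        Q₀∩R₂ y m m′ = Q-onlyY′ zero y m (inj₂ (inj₂ m′))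

        Qi-disjoint : ∀ i → ¬ i ≡ j → ∀ y → y ∈ vertices (walk (path Q (suc i))) →
                      y ∈ vertices Q₀ ⊎ y ∈ vertices Qj ⊎ y ∈ vertices P₂ ⊎ y ∈ vertices R₂ → ⊥
        Qi-disjoint i i≢j y m (inj₁ m′) with disjoint Q (suc i) zero y m m′
        ... | ()
        Qi-disjoint i i≢j y m (inj₂ (inj₁ m′)) = i≢j (suc-injective (disjoint Q (suc i) (suc j) y m m′))
        Qi-disjoint i i≢j y m (inj₂ (inj₂ (inj₁ m′)))
          with trans (Q-onlyY′ (suc i) y m (inj₂ (inj₁ m′))) (Q-end i i≢j)
        ... | refl = i≢j (disjoint F i j y (end∈ (P i)) (P₂⊆Pj m′))
        Qi-disjoint i i≢j y m (inj₂ (inj₂ (inj₂ m′)))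
          with trans (Q-onlyY′ (suc i) y m (inj₂ (inj₂ m′))) (Q-end i i≢j)
        ... | refl with R₂∩P m′ (end∈ (P i))
        ...   | refl = i≢j (disjoint F i j _ (end∈ (P i)) x∈Pj)

        Extension : Set
        Extension = Σ (Linkage Y (suc m)) λ L → Extends L F

        QjP₂ : Σ (Walk (start (path Q (suc j))) (end (path F j))) λ w → IsXYPath X Y w ×
                 (∀ y → y ∈ vertices w → y ∈ vertices Qj ⊎ y ∈ vertices P₂)
        QjP₂ = concatXY Qj Qj-end P₂ (startX (isXYPath (path Q (suc j)))) (endY (isXYPath (path F j)))
                 Qj-onlyX (λ y m xy → x-onlyX y (P₂-onlyX y m xy) xy)
                 (λ y m yy → ⊥-elim (Qj-avoidsY y m yy)) P₂-onlyY

        z∈P₂ : z ∈ vertices P₂ → Extension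
        z∈P₂ z∈ with suffixFrom P₂ (proj₁ (proj₂ P₁P₂-simple)) z∈ z≢x
        ... | P₂b , P₂b⊆ , x∉P₂b =
          replaceTwo (λ _ → inj₁) F j Q Q-end
                     (xyPath (proj₁ Z) (proj₁ (proj₂ Z))) (xyPath (proj₁ J) (proj₁ (proj₂ J)))
                     refl Z∩J Qi∩ZJ
          where
          Z : Σ (Walk (start (path Q (suc j))) (end R)) λ w → IsXYPath X Y w ×
                (∀ y → y ∈ vertices w → y ∈ vertices Qj ⊎ y ∈ vertices R₂)
          Z = concatXY Qj Qj-end R₂ (startX (isXYPath (path Q (suc j)))) (endY (isXYPath R)) Qj-onlyX
                (λ y m xy → x-onlyX y (R₂-onlyX y m xy) xy) (λ y m yy → ⊥-elim (Qj-avoidsY y m yy)) R₂-onlyY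
          J : Σ (Walk (start (path Q zero)) (end (path F j))) λ w → IsXYPath X Y w ×
                (∀ y → y ∈ vertices w → y ∈ vertices Q₀ ⊎ y ∈ vertices P₂b)
          J = concatXY Q₀ refl P₂b (startX (isXYPath (path Q zero))) (endY (isXYPath (path F j)))
                (onlyStartX (isXYPath (path Q zero)))
                (λ y m xy → ⊥-elim (x∉P₂b (subst (_∈ vertices P₂b) (P₂-onlyX y (P₂b⊆ m) xy) m)))
                (λ y m yy → trans (Q₀-onlyY y m yy) (P₂-onlyY z z∈ (subst Y (Q₀-onlyY y m yy) yy)))
                (λ y m → P₂-onlyY y (P₂b⊆ m))
          Z∩J : ∀ y → y ∈ vertices (proj₁ Z) → y ∈ vertices (proj₁ J) → ⊥
          Z∩J y m m′ with proj₂ (proj₂ Z) y m | proj₂ (proj₂ J) y m′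
          ... | inj₁ a | inj₁ b = Q₀∩Qj y b a
          ... | inj₁ a | inj₂ b with Qj∩P₂ y a (P₂b⊆ b)
          ...   | refl = x∉P₂b b
          Z∩J y m m′ | inj₂ a | inj₁ b with Q₀∩R₂ y b a
          ... | refl = z≢x (R₂∩P a (P₂⊆Pj z∈))
          Z∩J y m m′ | inj₂ a | inj₂ b with R₂∩P a (P₂⊆Pj (P₂b⊆ b))
          ... | refl = x∉P₂b b
          Qi∩ZJ : ∀ i → ¬ i ≡ j → ∀ y → y ∈ vertices (walk (path Q (suc i))) →
                  y ∈ vertices (proj₁ Z) ⊎ y ∈ vertices (proj₁ J) → ⊥
          Qi∩ZJ i i≢j y m (inj₁ a) with proj₂ (proj₂ Z) y a
          ... | inj₁ b = Qi-disjoint i i≢j y m (inj₂ (inj₁ b))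
          ... | inj₂ b = Qi-disjoint i i≢j y m (inj₂ (inj₂ (inj₂ b)))
          Qi∩ZJ i i≢j y m (inj₂ a) with proj₂ (proj₂ J) y a
          ... | inj₁ b = Qi-disjoint i i≢j y m (inj₁ b)
          ... | inj₂ b = Qi-disjoint i i≢j y m (inj₂ (inj₂ (inj₁ (P₂b⊆ b))))

        z∈R₂ : ¬ z ∈ vertices P₂ → z ∈ vertices R₂ → Extension
        z∈R₂ z∉P₂ z∈ with suffixFrom R₂ (proj₁ (proj₂ R₁R₂-simple)) z∈ z≢x
        ... | R₂b , R₂b⊆ , x∉R₂b =
          replaceTwo (λ _ → inj₁) F j Q Q-end
                     (xyPath (proj₁ Z) (proj₁ (proj₂ Z))) (xyPath (proj₁ QjP₂) (proj₁ (proj₂ QjP₂)))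
                     refl Z∩J Qi∩ZJ
          where
          Z : Σ (Walk (start (path Q zero)) (end R)) λ w → IsXYPath X Y w ×
                (∀ y → y ∈ vertices w → y ∈ vertices Q₀ ⊎ y ∈ vertices R₂b)
          Z = concatXY Q₀ refl R₂b (startX (isXYPath (path Q zero))) (endY (isXYPath R))
                (onlyStartX (isXYPath (path Q zero)))
                (λ y m xy → ⊥-elim (x∉R₂b (subst (_∈ vertices R₂b) (R₂-onlyX y (R₂b⊆ m) xy) m)))
                (λ y m yy → trans (Q₀-onlyY y m yy) (R₂-onlyY z z∈ (subst Y (Q₀-onlyY y m yy) yy)))
                (λ y m → R₂-onlyY y (R₂b⊆ m))
          Z∩J : ∀ y → y ∈ vertices (proj₁ Z) → y ∈ vertices (proj₁ QjP₂) → ⊥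
          Z∩J y m m′ with proj₂ (proj₂ Z) y m | proj₂ (proj₂ QjP₂) y m′
          ... | inj₁ a | inj₁ b = Q₀∩Qj y a b
          ... | inj₁ a | inj₂ b with Q₀∩P₂ y a b
          ...   | refl = z∉P₂ b
          Z∩J y m m′ | inj₂ a | inj₁ b with Qj∩R₂ y b (R₂b⊆ a)
          ... | refl = x∉R₂b a
          Z∩J y m m′ | inj₂ a | inj₂ b with R₂∩P (R₂b⊆ a) (P₂⊆Pj b)
          ... | refl = x∉R₂b a
          Qi∩ZJ : ∀ i → ¬ i ≡ j → ∀ y → y ∈ vertices (walk (path Q (suc i))) →
                  y ∈ vertices (proj₁ Z) ⊎ y ∈ vertices (proj₁ QjP₂) → ⊥
          Qi∩ZJ i i≢j y m (inj₁ a) with proj₂ (proj₂ Z) y a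
          ... | inj₁ b = Qi-disjoint i i≢j y m (inj₁ b)
          ... | inj₂ b = Qi-disjoint i i≢j y m (inj₂ (inj₂ (inj₂ (R₂b⊆ b))))
          Qi∩ZJ i i≢j y m (inj₂ a) with proj₂ (proj₂ QjP₂) y a
          ... | inj₁ b = Qi-disjoint i i≢j y m (inj₂ (inj₁ b))
          ... | inj₂ b = Qi-disjoint i i≢j y m (inj₂ (inj₂ (inj₁ b)))

        z∈Y : ¬ z ∈ vertices P₂ → Y z → Extension
        z∈Y z∉P₂ yz =
          replaceTwo (λ _ → inj₁) F j Q Q-end (xyPath Q₀ Q₀-isXY) (xyPath (proj₁ QjP₂) (proj₁ (proj₂ QjP₂)))
                     refl Z∩J Qi∩ZJ
          where
          Q₀-isXY : IsXYPath X Y Q₀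
          Q₀-isXY = record { simple = simple (isXYPath (path Q zero)) ; startX = startX (isXYPath (path Q zero))
                           ; endY = yz ; onlyStartX = onlyStartX (isXYPath (path Q zero)) ; onlyEndY = Q₀-onlyY }
          Z∩J : ∀ y → y ∈ vertices Q₀ → y ∈ vertices (proj₁ QjP₂) → ⊥
          Z∩J y m m′ with proj₂ (proj₂ QjP₂) y m′
          ... | inj₁ b = Q₀∩Qj y m b
          ... | inj₂ b with Q₀∩P₂ y m b
          ...   | refl = z∉P₂ b
          Qi∩ZJ : ∀ i → ¬ i ≡ j → ∀ y → y ∈ vertices (walk (path Q (suc i))) →
                  y ∈ vertices Q₀ ⊎ y ∈ vertices (proj₁ QjP₂) → ⊥
          Qi∩ZJ i i≢j y m (inj₁ a) = Qi-disjoint i i≢j y m (inj₁ a)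
          Qi∩ZJ i i≢j y m (inj₂ a) with proj₂ (proj₂ QjP₂) y a
          ... | inj₁ b = Qi-disjoint i i≢j y m (inj₂ (inj₁ b))
          ... | inj₂ b = Qi-disjoint i i≢j y m (inj₂ (inj₂ (inj₁ b)))

        extension : Extension
        extension with z ∈? vertices P₂
        ... | yes z∈P₂′ = z∈P₂ z∈P₂′
        ... | no z∉P₂ with z ∈? vertices R₂
        ...   | yes z∈R₂′ = z∈R₂ z∉P₂ z∈R₂′
        ...   | no z∉R₂ with endY (isXYPath (path Q zero))
        ...     | inj₁ yz         = z∈Y z∉P₂ yz
        ...     | inj₂ (inj₁ z∈′) = ⊥-elim (z∉P₂ z∈′)
        ...     | inj₂ (inj₂ z∈′) = ⊥-elim (z∉R₂ z∈′)

      extensionOrSeparator : ExtensionOrSeparator Y F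
      extensionOrSeparator with recurse Y′? Y′-smaller F′
      ... | inj₂ (g , separates) = inj₂ (g , λ p xa yc → separates p xa (inj₁ yc))
      ... | inj₁ (Q , Q-extends) = inj₁ (Recombine.extension Q Q-extends)

    addDisjointPath : ∀ {m Y} (F : Linkage Y m) (R : XYPath X Y) →
                      (∀ y → y ∈ vertices (walk R) → ¬ OnLinkage F y) → Σ (Linkage Y (suc m)) λ L → Extends L F
    addDisjointPath {m} {Y} F R R-disjoint = record { path = path′ ; disjoint = disjoint′ } , λ _ → refl
      where
      path′ : Fin (suc m) → XYPath X Y
      path′ zero    = R
      path′ (suc i) = path F i
      disjoint′ : ∀ t t′ y → y ∈ vertices (walk (path′ t)) → y ∈ vertices (walk (path′ t′)) → t ≡ t′
      disjoint′ zero    zero     y m m′ = refl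
      disjoint′ zero    (suc i)  y m m′ = ⊥-elim (R-disjoint y m (i , m′))
      disjoint′ (suc i) zero     y m m′ = ⊥-elim (R-disjoint y m′ (i , m))
      disjoint′ (suc i) (suc i′) y m m′ = cong suc (disjoint F i i′ y m m′)

    extensionOrSeparator′ : ∀ {m Y} (Y? : Decidable Y) → Acc _<_ (#outside Y?) →
                            (F : Linkage Y m) → ExtensionOrSeparator Y F
    extensionOrSeparator′ Y? (acc smaller) F
      with Reachability.pathAvoidingOrSeparator X? Y? (λ u → any? (λ j → end (path F j) ≟ u))
    ... | inj₂ separates = inj₂ ((λ j → end (path F j)) , separates)
    ... | inj₁ (R , R-avoids) with splitAtLast (λ y → any? (λ i → y ∈? vertices (walk (path F i)))) (walk R)
    ...   | inj₁ R-disjoint = inj₁ (addDisjointPath F R R-disjoint)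
    ...   | inj₂ (x , (j , x∈Pj) , R₁ , R₂ , R≡ , R₂-last) =
      Reroute.extensionOrSeparator Y? F R R-avoids x j x∈Pj R₁ R₂ R≡ R₂-last
        (λ Y′? fewer F′ → extensionOrSeparator′ Y′? (smaller fewer) F′)

    extensionOrSeparator : ∀ {m Y} (Y? : Decidable Y) (F : Linkage Y m) → ExtensionOrSeparator Y F
    extensionOrSeparator Y? = extensionOrSeparator′ Y? (<-wellFounded _)

module Transfer {N : ℕ} {E E′ : Fin N → Fin N → Set} (E? : ∀ x y → Dec (E x y)) (E′? : ∀ x y → Dec (E′ x y))
  where

  open import Data.List.Membership.Propositional using (_∈_)

  private
    module From = Walks E E?
    module To = Walks E′ E′?

  -- Only the final edge of the walk may leave O, and it is redirected to a vertex c′ chosen by lastEdge.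
  transfer : ∀ {O Target : Pred (Fin N) 0ℓ} → (∀ {x y} → O x → O y → E x y → E′ x y) → ∀ {a c} →
    (∀ {b} → O b → E b c → Σ (Fin N) λ c′ → Target c′ × E′ b c′) →
    (p : From.Walk a c) → From.Simple p → (∀ y → y ∈ From.vertices p → y ≡ c ⊎ O y) → O a → ¬ O c →
    Σ (Fin N) λ c′ → Target c′ × Σ (To.Walk a c′) λ q →
      ∀ y → y ∈ To.vertices q → (y ∈ From.vertices p × O y) ⊎ y ≡ c′
  transfer inner lastEdge From.[ a ] _ _ oa ¬oc = ⊥-elim (¬oc oa)
  transfer inner lastEdge (a From.∷⟨ e ⟩ From.[ c ]) _ _ oa ¬oc with lastEdge oa e
  ... | c′ , target , e′ = c′ , target , a To.∷⟨ e′ ⟩ To.[ c′ ] , onQ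
    where
    onQ : ∀ y → y ∈ To.vertices (a To.∷⟨ e′ ⟩ To.[ c′ ]) → _
    onQ y (here refl)         = inj₁ (here refl , oa)
    onQ y (there (here refl)) = inj₂ refl
  transfer {O} inner lastEdge (a From.∷⟨ e ⟩ p@(b From.∷⟨ e′ ⟩ p′)) (_ , b∉ , simp) outside oa ¬oc =
    let c′ , target , q , onQ = transfer inner lastEdge p (b∉ , simp) (λ y m → outside y (there m)) ob ¬oc
    in c′ , target , a To.∷⟨ inner oa ob e ⟩ q , onQ′ onQ
    where
    interior : b ≡ _ ⊎ O b → O b
    interior (inj₁ refl) = ⊥-elim (b∉ (From.end∈ p′))
    interior (inj₂ ob)   = ob
    ob : O b
    ob = interior (outside b (there (here refl)))
    onQ′ : ∀ {c′} {q : To.Walk b c′} → (∀ y → y ∈ To.vertices q → (y ∈ From.vertices p × O y) ⊎ y ≡ c′) →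
           ∀ y → y ∈ To.vertices (a To.∷⟨ inner oa ob e ⟩ q) →
           (y ∈ From.vertices (a From.∷⟨ e ⟩ p) × O y) ⊎ y ≡ c′
    onQ′ onQ y (here refl) = inj₁ (here refl , oa)
    onQ′ onQ y (there m) with onQ y m
    ... | inj₁ (m′ , oy) = inj₁ (there m′ , oy)
    ... | inj₂ y≡c′     = inj₂ y≡c′

module _ {A : Set} (f : A → Bool) where

  open import Data.List.Membership.Propositional using (_∈_)

  indicatorSum : List A → ℕ
  indicatorSum xs = sum (map (λ y → if f y then 1 else 0) xs)

  indicatorSum-pos : ∀ {y} xs → y ∈ xs → T (f y) → 1 ≤ indicatorSum xs
  indicatorSum-pos {y} (z ∷ xs) (here refl) fy with f y
  ... | true = s≤s z≤n
  indicatorSum-pos (z ∷ xs) (there m) fy = ≤-trans (indicatorSum-pos xs m fy) (m≤n+m _ (if f z then 1 else 0))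

  indicatorSum≡0⇒none : ∀ {y} xs → indicatorSum xs ≡ 0 → y ∈ xs → ¬ T (f y)
  indicatorSum≡0⇒none xs sum≡0 m fy = 1+n≰n (subst (1 ≤_) sum≡0 (indicatorSum-pos xs m fy))

  indicatorSum≡1⇒unique : ∀ xs → indicatorSum xs ≡ 1 →
                          ∀ {b b′} → b ∈ xs → b′ ∈ xs → T (f b) → T (f b′) → b ≡ b′
  indicatorSum≡1⇒unique (z ∷ xs) s (here refl) (here refl) fb fb′ = refl
  indicatorSum≡1⇒unique (z ∷ xs) s {b} (here refl) (there m′) fb fb′ with f b
  ... | true = ⊥-elim (indicatorSum≡0⇒none xs (ℕ.suc-injective s) m′ fb′)
  indicatorSum≡1⇒unique (z ∷ xs) s {b′ = b′} (there m) (here refl) fb fb′ with f b′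
  ... | true = ⊥-elim (indicatorSum≡0⇒none xs (ℕ.suc-injective s) m fb)
  indicatorSum≡1⇒unique (z ∷ xs) s (there m) (there m′) fb fb′ with f z
  ... | false = indicatorSum≡1⇒unique xs s m m′ fb fb′
  ... | true  = ⊥-elim (indicatorSum≡0⇒none xs (ℕ.suc-injective s) m fb)

module GraphWalks {n : ℕ} (G : Graph n) where

  open import Data.List.Membership.Propositional using (_∈_)

  open Walks (Adj G) (λ x y → T? (adj G x y)) public

  walkFromList : (x : V) (rest : List V) {y : V} → Linked (Adj G) (x ∷ rest) → last (x ∷ rest) ≡ just y →
                 Σ (Walk x y) λ w → vertices w ≡ x ∷ rest
  walkFromList x [] linked refl = [ x ] , refl
  walkFromList x (z ∷ rest) (e ∷ linked) ends with walkFromList z rest linked ends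
  ... | w , w≡ = x ∷⟨ e ⟩ w , cong (x ∷_) w≡

  Unique⇒Simple : ∀ {a c} (w : Walk a c) → Unique (vertices w) → Simple w
  Unique⇒Simple [ a ]        _            = tt
  Unique⇒Simple (a ∷⟨ e ⟩ w) (a∉ ∷ uniq) = All¬⇒¬Any a∉ , Unique⇒Simple w uniq

  Simple⇒Unique : ∀ {a c} (w : Walk a c) → Simple w → Unique (vertices w)
  Simple⇒Unique [ a ]        _           = [] ∷ []
  Simple⇒Unique (a ∷⟨ e ⟩ w) (a∉ , simp) = ¬Any⇒All¬ (vertices w) a∉ ∷ Simple⇒Unique w simp

  last-vertices : ∀ {a c} (w : Walk a c) → last (vertices w) ≡ just c
  last-vertices [ a ]                       = refl
  last-vertices (a ∷⟨ e ⟩ [ b ])            = refl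
  last-vertices (a ∷⟨ e ⟩ b ∷⟨ e′ ⟩ w) = last-vertices (b ∷⟨ e′ ⟩ w)

  linked-vertices : ∀ {a c} (w : Walk a c) → Linked (Adj G) (vertices w)
  linked-vertices [ a ]                       = [-]
  linked-vertices (a ∷⟨ e ⟩ [ b ])            = e ∷ [-]
  linked-vertices (a ∷⟨ e ⟩ b ∷⟨ e′ ⟩ w) = e ∷ linked-vertices (b ∷⟨ e′ ⟩ w)

  pathToWalk : ∀ {x y p} → PathFromTo G x y p → Σ (Walk x y) λ w → Simple w × vertices w ≡ p
  pathToWalk {p = []}       ((p≢[] , _ , _) , _ , _)            = ⊥-elim (p≢[] refl)
  pathToWalk {p = x ∷ rest} ((_ , uniq , linked) , refl , ends) with walkFromList x rest linked ends
  ... | w , w≡ = w , Unique⇒Simple w (subst Unique (sym w≡) uniq) , w≡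

  walkToPath : ∀ {a c} (w : Walk a c) → Simple w → PathFromTo G a c (vertices w)
  walkToPath [ a ]        simp = ((λ ()) , Simple⇒Unique [ a ] simp , [-]) , refl , refl
  walkToPath (a ∷⟨ e ⟩ w) simp =
    ((λ ()) , Simple⇒Unique (a ∷⟨ e ⟩ w) simp , linked-vertices (a ∷⟨ e ⟩ w)) ,
    refl , last-vertices (a ∷⟨ e ⟩ w)

  UniqueNeighbour : V → Set
  UniqueNeighbour y = ∀ {b b′} → Adj G y b → Adj G y b′ → b ≡ b′

  degree≡1⇒uniqueNeighbour : ∀ y → degree G y ≡ 1 → UniqueNeighbour y
  degree≡1⇒uniqueNeighbour y deg {b} {b′} =
    indicatorSum≡1⇒unique (adj G y) (allFin n) deg (∈-allFin b) (∈-allFin b′)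

  uniqueNeighbour⇒endpoint : ∀ {a c y} (w : Walk a c) → Simple w → y ∈ vertices w → UniqueNeighbour y →
                             y ≡ a ⊎ y ≡ c
  uniqueNeighbour⇒endpoint [ a ]                   _ (here refl)         _ = inj₁ refl
  uniqueNeighbour⇒endpoint (a ∷⟨ e ⟩ w)            _ (here refl)         _ = inj₁ refl
  uniqueNeighbour⇒endpoint (a ∷⟨ e ⟩ [ b ])        _ (there (here refl)) _ = inj₂ refl
  uniqueNeighbour⇒endpoint (a ∷⟨ e ⟩ b ∷⟨ e′ ⟩ w) (a∉ , simp) (there m) unique
    with uniqueNeighbour⇒endpoint (b ∷⟨ e′ ⟩ w) simp m unique
  ... | inj₂ y≡c  = inj₂ y≡c
  ... | inj₁ refl = ⊥-elim (a∉ (subst (_∈ vertices (b ∷⟨ e′ ⟩ w)) (unique e′ (subst T (adj-sym G a b) e))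
                                     (there (start∈ w))))

  leaf-onlyAtEnd : ∀ {a c y} (w : Walk a c) → Simple w → y ∈ vertices w → degree G y ≡ 1 → ¬ y ≡ a → y ≡ c
  leaf-onlyAtEnd w simp m deg y≢a with uniqueNeighbour⇒endpoint w simp m (degree≡1⇒uniqueNeighbour _ deg)
  ... | inj₁ y≡a = ⊥-elim (y≢a y≡a)
  ... | inj₂ y≡c = y≡c

  Separates-mono : ∀ {U U′ X Y : Pred V 0ℓ} → (∀ u → U u → U′ u) → Separates G U X Y → Separates G U′ X Y
  Separates-mono U⊆U′ sep x y p xx yy p-path with sep x y p xx yy p-path
  ... | u , uU , u∈p = u , U⊆U′ u uU , u∈p

  Separates-fromSimple : ∀ {U X Y : Pred V 0ℓ} →
    (∀ {a c} (p : Walk a c) → Simple p → X a → Y c → ∃ λ u → U u × u ∈ vertices p) → Separates G U X Y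
  Separates-fromSimple sep x y p xx yy p-path with pathToWalk p-path
  ... | w , simp , refl = sep w simp xx yy

injective⇒surjective : ∀ {k} (f : Fin k → Fin k) → Injective _≡_ _≡_ f → ∀ y → ∃ λ x → f x ≡ y
injective⇒surjective {zero}  f inj ()
injective⇒surjective {suc k} f inj y with any? (λ x → f x ≟ y)
... | yes hit = hit
... | no miss with pigeonhole (n<1+n k) (λ x → punchOut {i = y} (λ y≡fx → miss (x , sym y≡fx)))
...   | i , j , i<j , same =
  ⊥-elim (<⇒≢ i<j (inj (punchOut-injective (λ e → miss (i , sym e)) (λ e → miss (j , sym e)) same)))

injective⇒permutation : ∀ {k} (f : Fin k → Fin k) → Injective _≡_ _≡_ f →
                        Σ (Permutation′ k) λ π → ∀ t → π ⟨$⟩ʳ t ≡ f t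
injective⇒permutation f inj =
  permutation f (λ y → proj₁ (injective⇒surjective f inj y)) (λ y → proj₂ (injective⇒surjective f inj y))
              (λ x → inj (proj₂ (injective⇒surjective f inj (f x)))) ,
  λ _ → refl

module Terminals {n : ℕ} (G : Graph n) {k : ℕ} (v : Fin k → Fin n) (W : Fin k → Subset n) where

  open import Data.List.Membership.Propositional using (_∈_)
  open GraphWalks G public

  X? : Decidable (InVs v)
  X? x = any? (λ i → v i ≟ x)
  Y? : Decidable (InWs W)
  Y? x = any? (λ j → x ∈S? W j)

  open Augmentation X? public

  -- σ arises by reindexing the paths by their starting terminals.
  disjointPaths : Injective _≡_ _≡_ v → (F : Linkage (InWs W) k) (κ : Permutation′ k) →
                  (∀ t → end (path F t) ∈S W (κ ⟨$⟩ʳ t)) → DisjointPaths G k v W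
  disjointPaths v-inj F κ F-ends = σ , P′ , starts-ends , only-vi , only-end , pairwise
    where
    startIndex : Fin k → Fin k
    startIndex t = proj₁ (startX (isXYPath (path F t)))
    startIndex-v : ∀ t → v (startIndex t) ≡ start (path F t)
    startIndex-v t = proj₂ (startX (isXYPath (path F t)))
    startIndex-injective : Injective _≡_ _≡_ startIndex
    startIndex-injective {t} {t′} same =
      disjoint F t t′ (start (path F t)) (start∈ (walk (path F t)))
        (subst (_∈ vertices (walk (path F t′)))
               (trans (sym (startIndex-v t′)) (trans (cong v (sym same)) (startIndex-v t)))
               (start∈ (walk (path F t′))))
    π : Permutation′ k
    π = proj₁ (injective⇒permutation startIndex startIndex-injective)
    τ : Fin k → Fin k
    τ i = π ⟨$⟩ˡ i
    σ : Permutation′ k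
    σ = flip π ∘ₚ κ
    P′ : Fin k → List V
    P′ i = vertices (walk (path F (τ i)))
    v≡start : ∀ i → v i ≡ start (path F (τ i))
    v≡start i =
      trans (cong v (trans (sym (inverseʳ π)) (proj₂ (injective⇒permutation startIndex startIndex-injective) (τ i))))
            (startIndex-v (τ i))
    starts-ends : ∀ i → ∃ λ w → PathFromTo G (v i) w (P′ i) × w ∈S W (σ ⟨$⟩ʳ i)
    starts-ends i = end (path F (τ i)) ,
                    subst (λ s → PathFromTo G s (end (path F (τ i))) (P′ i)) (sym (v≡start i))
                          (walkToPath _ (simple (isXYPath (path F (τ i))))) ,
                    F-ends (τ i)
    only-vi : ∀ i j → v j ∈ P′ i → j ≡ i
    only-vi i j m = v-inj (trans (onlyStartX (isXYPath (path F (τ i))) (v j) m (j , refl)) (sym (v≡start i)))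
    only-end : ∀ i x → x ∈ P′ i → InWs W x → last (P′ i) ≡ just x
    only-end i x m yx = subst (λ u → last (P′ i) ≡ just u) (sym (onlyEndY (isXYPath (path F (τ i))) x m yx))
                              (last-vertices (walk (path F (τ i))))
    pairwise : ∀ i j x → x ∈ P′ i → x ∈ P′ j → i ≡ j
    pairwise i j x m m′ =
      trans (sym (inverseʳ π)) (trans (cong (π ⟨$⟩ʳ_) (disjoint F (τ i) (τ j) x m m′)) (inverseʳ π))

  xyPathWithinTo : ∀ {a c} (w : Walk a c) → InVs v a → InWs W c → (∀ y → y ∈ vertices w → InWs W y → y ≡ c) →
                   Σ (XYPath (InVs v) (InWs W)) λ r → vertices (walk r) ⊆ vertices w × end r ≡ c
  xyPathWithinTo w xa yc onlyEnd with xyPathWithin X? Y? w xa yc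
  ... | r , r⊆w = r , r⊆w , onlyEnd (end r) (r⊆w (end∈ (walk r))) (endY (isXYPath r))

module SingletonTargets where

  open import Data.List.Membership.Propositional using (_∈_)

  singleton-members : ∀ {n} {S : Subset n} {w a b} → S ≡ ⁅ w ⁆ → a ∈S S → b ∈S S → a ≡ b
  singleton-members refl a∈ b∈ = trans (x∈⁅y⁆⇒x≡y _ a∈) (sym (x∈⁅y⁆⇒x≡y _ b∈))

  extendToFirstTarget : ∀ {n m} (G : Graph n) (v : Fin (suc m) → Fin n) (W : Fin (suc m) → Subset n) →
    Injective _≡_ _≡_ v → (∀ j a b → a ∈S W (suc j) → b ∈S W (suc j) → a ≡ b) →
    let open Terminals G v W in
    (F : Linkage (InWs W) m) (σ : Permutation′ m) → (∀ i → end (path F i) ∈S W (suc (σ ⟨$⟩ʳ i))) →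
    DisjointPaths G (suc m) v W ⊎
    (Σ (Fin m → Fin n) λ g → Separates G (λ u → ∃ λ j → g j ≡ u) (InVs v) (InWs W))
  extendToFirstTarget {n} {m} G v W v-inj singleton F σ F-ends with Terminals.extensionOrSeparator G v W (Terminals.Y? G v W) F
  ... | inj₂ (g , sep) = inj₂ (g , GraphWalks.Separates-fromSimple G (λ p _ → sep p))
  ... | inj₁ (L , L-extends) = inj₁ (disjointPaths v-inj L (lift₀ σ) L-ends)
    where
    open Terminals G v W
    L-ends : ∀ t → end (path L t) ∈S W (lift₀ σ ⟨$⟩ʳ t)
    L-ends (suc i) = subst (_∈S W (suc (σ ⟨$⟩ʳ i))) (sym (L-extends i)) (F-ends i)
    L-ends zero with endY (isXYPath (path L zero))
    ... | zero  , e∈ = e∈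
    ... | suc j , e∈ with disjoint L zero (suc (σ ⟨$⟩ˡ j)) _ (end∈ (walk (path L zero)))
                            (subst (_∈ vertices (walk (path L (suc (σ ⟨$⟩ˡ j))))) same-end (end∈ _))
      where
      same-end : end (path L (suc (σ ⟨$⟩ˡ j))) ≡ end (path L zero)
      same-end = singleton j _ _ (subst (λ t → end (path L (suc (σ ⟨$⟩ˡ j))) ∈S W (suc t)) (inverseʳ σ)
                                        (L-ends (suc (σ ⟨$⟩ˡ j))))
                                 e∈
    ... | ()

  twoSingletonTargets : ∀ (n : ℕ) (G : Graph n) (v : Fin 3 → Fin n) (W : Fin 3 → Subset n) (w₂ w₃ : Fin n) →
    Admissible v W → (∀ x → x ∈S W zero → degree G x ≡ 1) →
    W (suc zero) ≡ ⁅ w₂ ⁆ → W (suc (suc zero)) ≡ ⁅ w₃ ⁆ →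
    DisjointPaths G 2 (v ∘ suc) (W ∘ suc) →
    DisjointPaths G 3 v W ⊎ (∃ λ u₁ → ∃ λ u₂ → Separates G (λ x → x ≡ u₁ ⊎ x ≡ u₂) (InVs v) (InWs W))
  twoSingletonTargets n G v W w₂ w₃ (v-inj , _ , _ , v∉W) leaves W₁≡ W₂≡
                      (σ , P , P-ends , _ , P-onlyEnd , P-disjoint)
    with extendToFirstTarget G v W v-inj singleton F σ
           (λ i → subst (_∈S W (suc (σ ⟨$⟩ʳ i))) (sym (F-end i)) (w∈ i))
    where
    open Terminals G v W
    singleton : ∀ j a b → a ∈S W (suc j) → b ∈S W (suc j) → a ≡ b
    singleton zero       a b = singleton-members W₁≡
    singleton (suc zero) a b = singleton-members W₂≡
    w : Fin 2 → Fin n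
    w i = proj₁ (P-ends i)
    w∈ : ∀ i → w i ∈S W (suc (σ ⟨$⟩ʳ i))
    w∈ i = proj₂ (proj₂ (P-ends i))
    walkᵢ : ∀ i → Σ (Walk (v (suc i)) (w i)) λ p → Simple p × vertices p ≡ P i
    walkᵢ i = pathToWalk (proj₁ (proj₂ (P-ends i)))
    onlyEnd : ∀ i y → y ∈ vertices (proj₁ (walkᵢ i)) → InWs W y → y ≡ w i
    onlyEnd i y m (zero , y∈) =
      leaf-onlyAtEnd (proj₁ (walkᵢ i)) (proj₁ (proj₂ (walkᵢ i))) m (leaves y y∈) λ { refl → v∉W (suc i) zero y∈ }
    onlyEnd i y m (suc j , y∈) =
      just-injective (trans (sym (P-onlyEnd i y (subst (y ∈_) (proj₂ (proj₂ (walkᵢ i))) m) (j , y∈)))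
                            (proj₂ (proj₂ (proj₁ (proj₂ (P-ends i))))))
    trimmed : ∀ i → Σ (XYPath (InVs v) (InWs W)) λ r → vertices (walk r) ⊆ vertices (proj₁ (walkᵢ i)) × end r ≡ w i
    trimmed i = xyPathWithinTo (proj₁ (walkᵢ i)) (suc i , refl) (suc (σ ⟨$⟩ʳ i) , w∈ i) (onlyEnd i)
    F : Linkage (InWs W) 2
    F = record { path = λ i → proj₁ (trimmed i)
               ; disjoint = λ i i′ y m m′ → P-disjoint i i′ y (on-Pᵢ i (proj₁ (proj₂ (trimmed i)) m))
                                                              (on-Pᵢ i′ (proj₁ (proj₂ (trimmed i′)) m′)) }
      where
      on-Pᵢ : ∀ i {y} → y ∈ vertices (proj₁ (walkᵢ i)) → y ∈ P i
      on-Pᵢ i = subst (_ ∈_) (proj₂ (proj₂ (walkᵢ i)))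
    F-end : ∀ i → end (path F i) ≡ w i
    F-end i = proj₂ (proj₂ (trimmed i))
  ... | inj₁ paths          = inj₁ paths
  ... | inj₂ (g , separate) = inj₂ (g zero , g (suc zero) , Separates-mono image⊆ separate)
    where
    open GraphWalks G
    image⊆ : ∀ u → (∃ λ j → g j ≡ u) → u ≡ g zero ⊎ u ≡ g (suc zero)
    image⊆ u (zero , refl)     = inj₁ refl
    image⊆ u (suc zero , refl) = inj₂ refl

  singletonTarget : ∀ (n : ℕ) (G : Graph n) (v : Fin 2 → Fin n) (W : Fin 2 → Subset n) →
    Connected G → Admissible v W → (∀ x → x ∈S W zero → degree G x ≡ 1) → (∃ λ w₂ → W (suc zero) ≡ ⁅ w₂ ⁆) →
    DisjointPaths G 2 v W ⊎ (∃ λ u → Separates G (λ x → x ≡ u) (InVs v) (InWs W))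
  singletonTarget n G v W connected (v-inj , _ , _ , v∉W) leaves (w₂ , W₁≡)
    with extendToFirstTarget G v W v-inj singleton F Permutation.id
           (λ { zero → subst (_∈S W (suc zero)) (sym F-end) w₂∈ })
    where
    open Terminals G v W
    w₂∈ : w₂ ∈S W (suc zero)
    w₂∈ = subst (w₂ ∈S_) (sym W₁≡) (x∈⁅x⁆ w₂)
    singleton : ∀ j a b → a ∈S W (suc j) → b ∈S W (suc j) → a ≡ b
    singleton zero a b = singleton-members W₁≡
    p : Σ (Walk (v zero) w₂) λ p → Simple p × vertices p ≡ proj₁ (connected (v zero) w₂)
    p = pathToWalk (proj₂ (connected (v zero) w₂))
    onlyEnd : ∀ y → y ∈ vertices (proj₁ p) → InWs W y → y ≡ w₂
    onlyEnd y m (zero , y∈)     =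
      leaf-onlyAtEnd (proj₁ p) (proj₁ (proj₂ p)) m (leaves y y∈) λ { refl → v∉W zero zero y∈ }
    onlyEnd y m (suc zero , y∈) = x∈⁅y⁆⇒x≡y w₂ (subst (y ∈S_) W₁≡ y∈)
    trimmed : Σ (XYPath (InVs v) (InWs W)) λ r → vertices (walk r) ⊆ vertices (proj₁ p) × end r ≡ w₂
    trimmed = xyPathWithinTo (proj₁ p) (zero , refl) (suc zero , w₂∈) onlyEnd
    F : Linkage (InWs W) 1
    F = record { path = λ _ → proj₁ trimmed ; disjoint = λ { zero zero _ _ _ → refl } }
    F-end : end (path F zero) ≡ w₂
    F-end = proj₂ (proj₂ trimmed)
  ... | inj₁ paths          = inj₁ paths
  ... | inj₂ (g , separate) = inj₂ (g zero , GraphWalks.Separates-mono G (λ { u (zero , refl) → refl }) separate)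


module LeafTargets {n : ℕ} (G : Graph n) (v : Fin 2 → Fin n) (W : Fin 2 → Subset n)
  (connected : Connected G) (v-inj : Injective _≡_ _≡_ v)
  (W-disjoint : ∀ (i j : Fin 2) (x : Fin n) → x ∈S W i → x ∈S W j → i ≡ j)
  (W-nonempty : ∀ (i : Fin 2) → Nonempty (W i))
  (v∉W : ∀ (i j : Fin 2) → ¬ (v i ∈S W j))
  (leaves₀ : ∀ x → x ∈S W zero → degree G x ≡ 1)
  (leaves₁ : ∀ x → x ∈S W (suc zero) → degree G x ≡ 1) where

  open import Data.List.Membership.Propositional using (_∈_)
  open Terminals G v W

  W₀ W₁ : Subset n
  W₀ = W zero
  W₁ = W (suc zero)

  w₂ : V
  w₂ = proj₁ (W-nonempty (suc zero))
  w₂∈W₁ : w₂ ∈S W₁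
  w₂∈W₁ = proj₂ (W-nonempty (suc zero))

  w₀ : V
  w₀ = proj₁ (W-nonempty zero)
  w₀∈W₀ : w₀ ∈S W₀
  w₀∈W₀ = proj₂ (W-nonempty zero)

  W₀∩W₁ : ∀ y → y ∈S W₀ → y ∈S W₁ → ⊥
  W₀∩W₁ y y∈W₀ y∈W₁ with W-disjoint zero (suc zero) y y∈W₀ y∈W₁
  ... | ()

  Outside : Pred V 0ℓ
  Outside y = ¬ y ∈S W₀ × ¬ y ∈S W₁
  Outside? : Decidable Outside
  Outside? y = ¬? (y ∈S? W₀) ×-dec ¬? (y ∈S? W₁)

  w₂-inside : ¬ Outside w₂
  w₂-inside (_ , w₂∉W₁) = w₂∉W₁ w₂∈W₁

  v-outside : ∀ {y} → InVs v y → Outside y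
  v-outside (i , refl) = v∉W i zero , v∉W i (suc zero)

  W-inside : ∀ {y} → InWs W y → ¬ Outside y
  W-inside (zero , y∈)     (y∉W₀ , _) = y∉W₀ y∈
  W-inside (suc zero , y∈) (_ , y∉W₁) = y∉W₁ y∈

  AttachedToW₁ : Pred V 0ℓ
  AttachedToW₁ x = ∃ λ w → w ∈S W₁ × Adj G x w

  -- The auxiliary graph: W₁ collapses onto w₂, which inherits all edges into W₁.
  Arc : V → V → Set
  Arc x y = Outside x × ((Outside y ⊎ y ∈S W₀) × Adj G x y ⊎ y ≡ w₂ × AttachedToW₁ x)

  Arc? : ∀ x y → Dec (Arc x y)
  Arc? x y = Outside? x ×-dec (((Outside? y ⊎-dec (y ∈S? W₀)) ×-dec T? (adj G x y)) ⊎-dec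
                                ((y ≟ w₂) ×-dec any? (λ w → w ∈S? W₁ ×-dec T? (adj G x w))))

  Link : V → V → Set
  Link x y = Arc x y ⊎ Arc y x

  Link? : ∀ x y → Dec (Link x y)
  Link? x y = Arc? x y ⊎-dec Arc? y x

  module Aux = Walks Link Link?
  module AuxAugmentation = Aux.Augmentation X?

  Y′ : Pred V 0ℓ
  Y′ y = y ∈S W₀ ⊎ y ≡ w₂
  Y′? : Decidable Y′
  Y′? y = (y ∈S? W₀) ⊎-dec (y ≟ w₂)

  Y′-inside : ∀ {y} → Y′ y → ¬ Outside y
  Y′-inside (inj₁ y∈W₀) (y∉W₀ , _) = y∉W₀ y∈W₀
  Y′-inside (inj₂ refl)  o          = w₂-inside o

  arc-target : ∀ {x y} → Arc x y → Outside y ⊎ Y′ y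
  arc-target (_ , inj₁ (inj₁ oy , _))   = inj₁ oy
  arc-target (_ , inj₁ (inj₂ y∈W₀ , _)) = inj₂ (inj₁ y∈W₀)
  arc-target (_ , inj₂ (y≡w₂ , _))      = inj₂ (inj₂ y≡w₂)

  link-endpoint : ∀ {x} → (∃ λ z → Link x z) ⊎ (∃ λ z → Link z x) → Outside x ⊎ Y′ x
  link-endpoint (inj₁ (_ , inj₁ arc)) = inj₁ (proj₁ arc)
  link-endpoint (inj₁ (_ , inj₂ arc)) = arc-target arc
  link-endpoint (inj₂ (_ , inj₁ arc)) = arc-target arc
  link-endpoint (inj₂ (_ , inj₂ arc)) = inj₁ (proj₁ arc)

  outside-link⇒adj : ∀ {x y} → Outside x → Outside y → Link x y → Adj G x y
  outside-link⇒adj ox oy (inj₁ (_ , inj₁ (_ , e)))     = e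
  outside-link⇒adj ox oy (inj₁ (_ , inj₂ (refl , _))) = ⊥-elim (w₂-inside oy)
  outside-link⇒adj ox oy (inj₂ (_ , inj₁ (_ , e)))     = subst T (adj-sym G _ _) e
  outside-link⇒adj ox oy (inj₂ (_ , inj₂ (refl , _))) = ⊥-elim (w₂-inside ox)

  outside-adj⇒link : ∀ {x y} → Outside x → Outside y → Adj G x y → Link x y
  outside-adj⇒link ox oy e = inj₁ (ox , inj₁ (inj₁ oy , e))

  outsideOrEnd : ∀ {a c} (p : Walk a c) → Simple p → InVs v a → ∀ y → y ∈ vertices p → y ≡ c ⊎ Outside y
  outsideOrEnd p simp xa y m with y ∈S? W₀ | y ∈S? W₁
  ... | yes y∈W₀ | _ = inj₁ (leaf-onlyAtEnd p simp m (leaves₀ y y∈W₀) λ { refl → proj₁ (v-outside xa) y∈W₀ })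
  ... | no _ | yes y∈W₁ = inj₁ (leaf-onlyAtEnd p simp m (leaves₁ y y∈W₁) λ { refl → proj₂ (v-outside xa) y∈W₁ })
  ... | no y∉W₀ | no y∉W₁ = inj₂ (y∉W₀ , y∉W₁)

  auxOutsideOrEnd : ∀ {a c} (q : Aux.Walk a c) → InVs v a → Y′ c → (∀ y → y ∈ Aux.vertices q → Y′ y → y ≡ c) →
                    ∀ y → y ∈ Aux.vertices q → y ≡ c ⊎ Outside y
  auxOutsideOrEnd q xa yc onlyEnd y m with Y′? y
  ... | yes yy = inj₁ (onlyEnd y m yy)
  auxOutsideOrEnd Aux.[ a ] xa yc onlyEnd y m | no _ = ⊥-elim (Y′-inside yc (v-outside xa))
  auxOutsideOrEnd (a Aux.∷⟨ e ⟩ q) xa yc onlyEnd y m | no ¬yy with link-endpoint (Aux.incident e q m)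
  ... | inj₁ oy = inj₂ oy
  ... | inj₂ yy = ⊥-elim (¬yy yy)

  module ToAux = Transfer (λ x y → T? (adj G x y)) Link?
  module FromAux = Transfer Link? (λ x y → T? (adj G x y))

  toAux : ∀ {a c} (p : Walk a c) → Simple p → InVs v a → ¬ Outside c → ∀ c′ →
          (∀ {b} → Outside b → Adj G b c → Link b c′) →
          Σ (Aux.Walk a c′) λ q → ∀ y → y ∈ Aux.vertices q → (y ∈ vertices p × Outside y) ⊎ y ≡ c′
  toAux p simp xa ¬oc c′ lastLink
    with ToAux.transfer {Target = _≡ c′} outside-adj⇒link (λ ob e → c′ , refl , lastLink ob e)
                        p simp (outsideOrEnd p simp xa) (v-outside xa) ¬oc
  ... | _ , refl , q , onQ = q , onQ

  data Landing (c c′ : V) : Set where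
    atW₀ : c ∈S W₀ → c′ ≡ c → Landing c c′
    atW₁ : c ≡ w₂ → c′ ∈S W₁ → Landing c c′

  landing : ∀ {b c} → ¬ Outside c → Link b c → Σ V λ c′ → Landing c c′ × Adj G b c′
  landing ¬oc (inj₁ (_ , inj₁ (inj₁ oc , _)))          = ⊥-elim (¬oc oc)
  landing ¬oc (inj₁ (_ , inj₁ (inj₂ c∈W₀ , e)))        = _ , atW₀ c∈W₀ refl , e
  landing ¬oc (inj₁ (_ , inj₂ (c≡w₂ , w , w∈W₁ , e))) = w , atW₁ c≡w₂ w∈W₁ , e
  landing ¬oc (inj₂ (oc , _))                           = ⊥-elim (¬oc oc)

  fromAux : (r : Aux.XYPath (InVs v) Y′) → Σ V λ c′ → Landing (Aux.end r) c′ × Σ (Walk (Aux.start r) c′) λ p →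
            ∀ y → y ∈ vertices p → (y ∈ Aux.vertices (Aux.walk r) × Outside y) ⊎ y ≡ c′
  fromAux r = FromAux.transfer outside-link⇒adj (λ _ → landing (Y′-inside (Aux.endY xy)))
                (Aux.walk r) (Aux.simple xy) (auxOutsideOrEnd (Aux.walk r) (Aux.startX xy) (Aux.endY xy) (Aux.onlyEndY xy))
                (v-outside (Aux.startX xy)) (Y′-inside (Aux.endY xy))
    where
    xy : Aux.IsXYPath (InVs v) Y′ (Aux.walk r)
    xy = Aux.isXYPath r

  auxPathFromV₀ : ∀ {c} → ¬ Outside c → ∀ c′ → (∀ {b} → Outside b → Adj G b c → Link b c′) →
                  Σ (Aux.Walk (v zero) c′) λ q → ∀ y → y ∈ Aux.vertices q → Outside y ⊎ y ≡ c′
  auxPathFromV₀ {c} ¬oc c′ lastLink with pathToWalk (proj₂ (connected (v zero) c))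
  ... | p , simp , _ with toAux p simp (zero , refl) ¬oc c′ lastLink
  ...   | q , onQ = q , λ y m → Data.Sum.map₁ proj₂ (onQ y m)

  initialLinkage : Σ (AuxAugmentation.Linkage Y′ 1) λ F → Aux.end (AuxAugmentation.path F zero) ≡ w₂
  initialLinkage with auxPathFromV₀ w₂-inside w₂ (λ ob e → inj₁ (ob , inj₂ (refl , w₂ , w₂∈W₁ , e)))
  ... | q , onQ with Aux.xyPathWithin X? Y′? q (zero , refl) (inj₂ refl)
  ...   | r , r⊆q = record { path = λ _ → r ; disjoint = λ { zero zero _ _ _ → refl } } , end≡
    where
    end≡ : Aux.end r ≡ w₂
    end≡ with onQ (Aux.end r) (r⊆q (Aux.end∈ (Aux.walk r)))
    ... | inj₁ o    = ⊥-elim (Y′-inside (Aux.endY (Aux.isXYPath r)) o)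
    ... | inj₂ end≡ = end≡

  -- w₂ cannot be the cut vertex, since a path from v₀ to W₀ avoids it in the auxiliary graph.
  separatorInG : (g : Fin 1 → V) → Aux.SeparatesWalks (λ u → ∃ λ j → g j ≡ u) (InVs v) Y′ →
                 ∃ λ u → Separates G (λ x → x ≡ u) (InVs v) (InWs W)
  separatorInG g sep with g zero ≟ w₂
  ... | yes g≡w₂ with auxPathFromV₀ (λ o → proj₁ o w₀∈W₀) w₀ (λ ob e → inj₁ (ob , inj₁ (inj₂ w₀∈W₀ , e)))
  ...   | q , onQ with sep q (zero , refl) (inj₁ w₀∈W₀)
  ...     | _ , (zero , refl) , m with onQ _ m
  ...       | inj₁ o   = ⊥-elim (w₂-inside (subst Outside g≡w₂ o))
  ...       | inj₂ g≡w₀ = ⊥-elim (W₀∩W₁ w₂ (subst (_∈S W₀) (trans (sym g≡w₀) g≡w₂) w₀∈W₀) w₂∈W₁)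
  separatorInG g sep | no g≢w₂ = g zero , Separates-fromSimple hit
    where
    hit : ∀ {a c} (p : Walk a c) → Simple p → InVs v a → InWs W c → ∃ λ u → u ≡ g zero × u ∈ vertices p
    hit {c = c} p simp xa (zero , c∈W₀)
      with toAux p simp xa (W-inside (zero , c∈W₀)) c (λ ob e → inj₁ (ob , inj₁ (inj₂ c∈W₀ , e)))
    ... | q , onQ with sep q xa (inj₁ c∈W₀)
    ...   | u , (zero , refl) , m with onQ u m
    ...     | inj₁ (u∈p , _) = u , refl , u∈p
    ...     | inj₂ refl      = u , refl , end∈ p
    hit {c = c} p simp xa (suc zero , c∈W₁)
      with toAux p simp xa (W-inside (suc zero , c∈W₁)) w₂ (λ ob e → inj₁ (ob , inj₂ (refl , c , c∈W₁ , e)))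
    ... | q , onQ with sep q xa (inj₂ refl)
    ...   | u , (zero , refl) , m with onQ u m
    ...     | inj₁ (u∈p , _) = u , refl , u∈p
    ...     | inj₂ g≡w₂      = ⊥-elim (g≢w₂ g≡w₂)

  linkageInG : (F₂ : AuxAugmentation.Linkage Y′ 2) → Aux.end (AuxAugmentation.path F₂ (suc zero)) ≡ w₂ →
               DisjointPaths G 2 v W
  linkageInG F₂ end₁≡w₂ = disjointPaths v-inj F Permutation.id c′∈W
    where
    r : Fin 2 → Aux.XYPath (InVs v) Y′
    r t = AuxAugmentation.path F₂ t
    back : ∀ t → Σ V λ c′ → Landing (Aux.end (r t)) c′ × Σ (Walk (Aux.start (r t)) c′) λ p →
             ∀ y → y ∈ vertices p → (y ∈ Aux.vertices (Aux.walk (r t)) × Outside y) ⊎ y ≡ c′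
    back t = fromAux (r t)
    c′ : Fin 2 → V
    c′ t = proj₁ (back t)
    p : ∀ t → Walk (Aux.start (r t)) (c′ t)
    p t = proj₁ (proj₂ (proj₂ (back t)))
    onP : ∀ t y → y ∈ vertices (p t) → (y ∈ Aux.vertices (Aux.walk (r t)) × Outside y) ⊎ y ≡ c′ t
    onP t = proj₂ (proj₂ (proj₂ (back t)))

    end₀≢w₂ : ¬ Aux.end (r zero) ≡ w₂
    end₀≢w₂ end₀≡w₂ with AuxAugmentation.disjoint F₂ zero (suc zero) w₂
                           (subst (_∈ Aux.vertices (Aux.walk (r zero))) end₀≡w₂ (Aux.end∈ (Aux.walk (r zero))))
                           (subst (_∈ Aux.vertices (Aux.walk (r (suc zero)))) end₁≡w₂
                                  (Aux.end∈ (Aux.walk (r (suc zero)))))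
    ... | ()

    c′∈W : ∀ t → c′ t ∈S W t
    c′∈W zero with proj₁ (proj₂ (back zero))
    ... | atW₀ c∈W₀ c′≡c = subst (_∈S W₀) (sym c′≡c) c∈W₀
    ... | atW₁ c≡w₂ _    = ⊥-elim (end₀≢w₂ c≡w₂)
    c′∈W (suc zero) with proj₁ (proj₂ (back (suc zero)))
    ... | atW₁ _ c′∈W₁  = c′∈W₁
    ... | atW₀ c∈W₀ _   = ⊥-elim (W₀∩W₁ w₂ (subst (_∈S W₀) end₁≡w₂ c∈W₀) w₂∈W₁)

    short : ∀ t → Shortcut (p t)
    short t = simplify (p t)

    short-isXY : ∀ t → IsXYPath (InVs v) (InWs W) (shortWalk (short t))
    short-isXY t = record { simple = shortSimple (short t) ; startX = Aux.startX (Aux.isXYPath (r t))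
                          ; endY = t , c′∈W t ; onlyStartX = onlyX ; onlyEndY = onlyY }
      where
      onlyX : ∀ y → y ∈ vertices (shortWalk (short t)) → InVs v y → y ≡ Aux.start (r t)
      onlyX y m xy with onP t y (short⊆ (short t) m)
      ... | inj₁ (m′ , _) = Aux.onlyStartX (Aux.isXYPath (r t)) y m′ xy
      ... | inj₂ refl     = ⊥-elim (W-inside (t , c′∈W t) (v-outside xy))
      onlyY : ∀ y → y ∈ vertices (shortWalk (short t)) → InWs W y → y ≡ c′ t
      onlyY y m yy with onP t y (short⊆ (short t) m)
      ... | inj₁ (_ , o) = ⊥-elim (W-inside yy o)
      ... | inj₂ y≡c′    = y≡c′

    F : Linkage (InWs W) 2
    F = record { path = λ t → xyPath (shortWalk (short t)) (short-isXY t) ; disjoint = disjoint′ }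
      where
      disjoint′ : ∀ t t′ y → y ∈ vertices (shortWalk (short t)) → y ∈ vertices (shortWalk (short t′)) → t ≡ t′
      disjoint′ t t′ y m m′ with onP t y (short⊆ (short t) m) | onP t′ y (short⊆ (short t′) m′)
      ... | inj₁ (a , _) | inj₁ (b , _) = AuxAugmentation.disjoint F₂ t t′ y a b
      ... | inj₁ (_ , o) | inj₂ refl    = ⊥-elim (W-inside (t′ , c′∈W t′) o)
      ... | inj₂ refl    | inj₁ (_ , o) = ⊥-elim (W-inside (t , c′∈W t) o)
      ... | inj₂ refl    | inj₂ y≡c′    = W-disjoint t t′ y (c′∈W t) (subst (_∈S W t′) (sym y≡c′) (c′∈W t′))

  disjointPathsOrCutVertex : DisjointPaths G 2 v W ⊎ (∃ λ u → Separates G (λ x → x ≡ u) (InVs v) (InWs W))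
  disjointPathsOrCutVertex with AuxAugmentation.extensionOrSeparator Y′? (proj₁ initialLinkage)
  ... | inj₂ (g , sep)        = inj₂ (separatorInG g sep)
  ... | inj₁ (F₂ , F₂-extends) = inj₁ (linkageInG F₂ (trans (F₂-extends zero) (proj₂ initialLinkage)))


open SingletonTargets using (singletonTarget; twoSingletonTargets)
open import Data.Fin.Subset using (_∈_)

lemma3p2 :
  (∀ (n : ℕ) (G : Graph n) (v : Fin 2 → Fin n) (W : Fin 2 → Subset n) →
    Connected G → Admissible v W →
    (∀ x → x ∈ W zero → degree G x ≡ 1) →
    ((∀ x → x ∈ W (suc zero) → degree G x ≡ 1) ⊎ (∃ λ w₂ → W (suc zero) ≡ ⁅ w₂ ⁆)) →
    DisjointPaths G 2 v W
      ⊎ (∃ λ u → Separates G (λ x → x ≡ u) (InVs v) (InWs W)))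
  ×
  (∀ (n : ℕ) (G : Graph n) (v : Fin 3 → Fin n) (W : Fin 3 → Subset n) (w₂ w₃ : Fin n) →
    Connected G → Admissible v W →
    (∀ x → x ∈ W zero → degree G x ≡ 1) →
    W (suc zero) ≡ ⁅ w₂ ⁆ → W (suc (suc zero)) ≡ ⁅ w₃ ⁆ →
    DisjointPaths G 2 (v ∘ suc) (W ∘ suc) →
    DisjointPaths G 3 v W
      ⊎ (∃ λ u₁ → ∃ λ u₂ →
           Separates G (λ x → x ≡ u₁ ⊎ x ≡ u₂) (InVs v) (InWs W)))
lemma3p2 =
  (λ { n G v W connected (v-inj , W-disjoint , W-nonempty , v∉W) leaves₀ (inj₁ leaves₁) →
         LeafTargets.disjointPathsOrCutVertex G v W connected v-inj W-disjoint W-nonempty v∉W leaves₀ leaves₁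
     ; n G v W connected admissible leaves₀ (inj₂ singleton) →
         singletonTarget n G v W connected admissible leaves₀ singleton }) ,
  λ n G v W w₂ w₃ _ → twoSingletonTargets n G v W w₂ w₃
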